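{- Let $K$ be an ordered core which contains a cycle. Then there is a constant $c>0$ such that for every sufficiently small $\varepsilon>0$ and every sufficiently large $n$ there is an $n$-vertex ordered graph $G$ such that: (1) there is a homomorphism from $G$ to $K$; (2) $G$ contains $\varepsilon n^2$ pairwise pair-disjoint induced copies of $K$; (3) $G$ has at most $\varepsilon^{c\log(1/\varepsilon)}n^{v(K)}$ (not necessarily induced) copies of $K$.
   Context: An ordered graph is a graph with a linear order $\leq$ on its vertex set. A copy of $H$ in $G$ is given by an order-preserving injection $V(H)\to V(G)$ mapping edges to edges; it is induced if non-edges are also mapped to non-edges. Two subgraphs are pair-disjoint if they share at most one vertex. A homomorphism from an ordered graph $G_1$ to an ordered graph $G_2$ is a map $\varphi:V(G_1)\to V(G_2)$ with $\{\varphi(x),\varphi(y)\}\in E(G_2)$ for every $\{x,y\}\in E(G_1)$ and $\varphi(x)\leq\varphi(y)$ whenever $x\leq y$. An ordered graph $K$ is a core if the only homomorphism from $K$ to itself is the identity.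
   Formalization: The parameter ε ranges over the positive rationals, and the constant c is taken in the positive rationals. -}

module Defs where

open import Data.Nat using (ℕ; zero; suc; _+_; _*_; _≤_; _<_)
open import Data.Fin using (Fin; toℕ; fromℕ) renaming (zero to fzero)
open import Data.Bool using (Bool; true; false)
open import Data.Integer using (+_)
open import Data.Rational using (ℚ; 1ℚ; _/_) renaming (_*_ to _*ℚ_; _<_ to _<ℚ_; _≤_ to _≤ℚ_)
open import Data.Product using (Σ; _×_; _,_; ∃; ∃-syntax; proj₁)
open import Data.List using (List; length)
open import Data.List.Relation.Unary.AllPairs using (AllPairs)
open import Relation.Binary.PropositionalEquality using (_≡_)
open import Relation.Nullary using (¬_)
open import Function.Definitions using (Injective)

-- Ordered graphs.  An ordered graph on n vertices has vertex set Fin n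
-- with its natural linear order; adjacency is a symmetric irreflexive
-- Bool-valued relation.

record OGraph (n : ℕ) : Set where
  field
    adj   : Fin n → Fin n → Bool
    sym   : ∀ x y → adj x y ≡ adj y x
    irref : ∀ x → adj x x ≡ false

open OGraph public

Edge : ∀ {n} → OGraph n → Fin n → Fin n → Set
Edge G x y = adj G x y ≡ true

-- Number of vertices v(K) is the index k of OGraph k.

IsHom : ∀ {n m} → OGraph n → OGraph m → (Fin n → Fin m) → Set
IsHom G H φ =
  (∀ x y → toℕ x ≤ toℕ y → toℕ (φ x) ≤ toℕ (φ y)) ×
  (∀ x y → Edge G x y → Edge H (φ x) (φ y))

HasHom : ∀ {n m} → OGraph n → OGraph m → Set
HasHom G H = Σ (_ → _) (IsHom G H)

IsCore : ∀ {k} → OGraph k → Set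
IsCore K = ∀ φ → IsHom K K φ → ∀ x → φ x ≡ x

HasCycle : ∀ {k} → OGraph k → Set
HasCycle {k} K = ∃[ m ] Σ (Fin (3 + m) → Fin k) λ v →
  Injective _≡_ _≡_ v ×
  (∀ i j → toℕ j ≡ suc (toℕ i) → Edge K (v i) (v j)) ×
  Edge K (v (fromℕ (2 + m))) (v fzero)

IsCopy : ∀ {k n} → OGraph k → OGraph n → (Fin k → Fin n) → Set
IsCopy K G φ =
  (∀ i j → toℕ i < toℕ j → toℕ (φ i) < toℕ (φ j)) ×
  (∀ i j → Edge K i j → Edge G (φ i) (φ j))

IsInducedCopy : ∀ {k n} → OGraph k → OGraph n → (Fin k → Fin n) → Set
IsInducedCopy K G φ =
  (∀ i j → toℕ i < toℕ j → toℕ (φ i) < toℕ (φ j)) ×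
  (∀ i j → adj G (φ i) (φ j) ≡ adj K i j)

Copy : ∀ {k n} → OGraph k → OGraph n → Set
Copy K G = Σ (_ → _) (IsCopy K G)

InducedCopy : ∀ {k n} → OGraph k → OGraph n → Set
InducedCopy K G = Σ (_ → _) (IsInducedCopy K G)

-- Two copies are pair-disjoint if their images share at most one vertex.
PairDisjoint : ∀ {k n} → (Fin k → Fin n) → (Fin k → Fin n) → Set
PairDisjoint φ ψ = ∀ i j i' j' → φ i ≡ ψ i' → φ j ≡ ψ j' → φ i ≡ φ j

-- Two copies are distinct if they differ as maps (for ordered graphs a
-- copy is determined by its vertex image, so this counts copies).
DistinctMaps : ∀ {k n} → (Fin k → Fin n) → (Fin k → Fin n) → Set
DistinctMaps φ ψ = ¬ (∀ i → φ i ≡ ψ i)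

ℕtoℚ : ℕ → ℚ
ℕtoℚ n = + n / 1

infixr 8 _^ℚ_
_^ℚ_ : ℚ → ℕ → ℚ
x ^ℚ zero  = 1ℚ
x ^ℚ suc e = x *ℚ (x ^ℚ e)

-- The real inequality   N ≤ ε ^ (c · log₂ (1/ε)) · D   for naturals N, D,
-- a rational 0 < ε < 1 and a rational c = a / b > 0, written with
-- rational arithmetic only.  Since s ↦ ε ^ s is continuous and
-- decreasing, N/D ≤ ε^(c·t) (t = log₂(1/ε) > 0) iff N/D ≤ ε^(p/q) for all
-- rationals 0 ≤ p/q < c·t; and
--   p/q < (a/b)·log₂(1/ε)  ⇔  2^(p b) < ε^(-q a)  ⇔  ε^(q a)·2^(p b) < 1,
--   N/D ≤ ε^(p/q)          ⇔  N^q ≤ ε^p · D^q.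
LePowLog : (a b : ℕ) (ε : ℚ) (N D : ℕ) → Set
LePowLog a b ε N D =
  ∀ p q → 1 ≤ q →
    (ε ^ℚ (q * a)) *ℚ (ℕtoℚ 2 ^ℚ (p * b)) <ℚ 1ℚ →
    ℕtoℚ N ^ℚ q ≤ℚ (ε ^ℚ p) *ℚ (ℕtoℚ D ^ℚ q)

{-# OPTIONS --safe #-}
module Submission where

-- Let v₀ … v_{ℓ-1} be a cycle of K, label v_j by j and the other vertices of K by larger
-- distinct labels λ.  G is a blow-up of K whose vertices carry a part i (a vertex of K), a
-- height y and a slot; (i, y) and (j, z) are adjacent iff ij ∈ E(K) and
-- z − y = (λ_j − λ_i)·a for some a in a set A ⊆ [0, M) in which
-- a₁ + … + a_{ℓ-1} = (ℓ-1)·a′ has only trivial solutions (Behrend: points of a sphere read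
-- in a base so large that no carries occur).  The maps i ↦ (i, x + λ_i a, u + i w) are
-- induced copies of K, and two of them share at most one vertex because a line is determined
-- by two of its points; there are M·|A|·t² ≈ ε n² of them.  Conversely, as K is a core,
-- every copy of K maps v_j into part v_j, and walking around the cycle gives
-- a₁ + … + a_{ℓ-1} = (ℓ-1)·a′, so all steps along the cycle coincide.  A copy is therefore
-- determined by its vertices other than v₁, v₂, the common step and the slots of v₁, v₂,
-- which leaves at most n^k / M copies.  With D base-2^D digits, M ≥ 2^{D²} while
-- ε ≈ 2^{-Θ(D)}, which is the bound ε^{c log(1/ε)}.

open import Defs hiding (sym)
open import Data.Nat
open import Data.Nat.Properties
open import Data.Nat.DivMod using (_/_; _%_; m≡m%n+[m/n]*n; m%n<n; m/n*n≤m; /-monoˡ-≤; m≥n⇒m/n>0)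
open import Data.Nat.Tactic.RingSolver using (solve-∀)
open import Data.Fin as Fin using (Fin; toℕ; fromℕ; fromℕ<; inject₁) renaming (zero to fzero; suc to fsuc)
open import Data.Fin.Properties using (toℕ<n; toℕ-injective; toℕ-fromℕ<; toℕ-fromℕ; toℕ-inject₁; any?; pigeonhole)
import Data.Integer as ℤ
import Data.Integer.Properties as ℤ
open import Data.Integer.GCD using (gcd)
open import Data.Rational as ℚ using (ℚ; 0ℚ; 1ℚ; mkℚ; ↥_; ↧_; toℚᵘ)
  renaming (_*_ to _*ℚ_; _<_ to _<ℚ_; _≤_ to _≤ℚ_)
import Data.Rational.Properties as ℚ
open import Data.Rational.Unnormalised as ℚᵘ using (mkℚᵘ; *≡*; *≤*; *<*)
import Data.Rational.Unnormalised.Properties as ℚᵘ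
open import Data.Bool using (Bool; true; false; _∧_; if_then_else_)
open import Data.Bool.Properties using (∧-identityʳ)
open import Data.Vec using (Vec; []; _∷_; head; tail)
open import Data.Vec.Properties using (∷-injective)
open import Data.List using (List; []; _∷_; length; filter; lookup; map; cartesianProduct; cartesianProductWith; allFin)
open import Data.List.Properties using (length-++; length-map; length-tabulate)
open import Data.List.Membership.Propositional.Properties using (∈-filter⁻; ∈-lookup)
open import Data.List.Relation.Unary.All using (All; []; _∷_)
open import Data.List.Relation.Unary.AllPairs using (AllPairs; []; _∷_)
import Data.List.Relation.Unary.AllPairs as AllPairs
import Data.List.Relation.Unary.AllPairs.Properties as AllPairs
open import Data.List.Relation.Unary.Unique.Propositional using (Unique)
import Data.List.Relation.Unary.Unique.Propositional.Properties as Unique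
open import Data.Product using (Σ; ∃; ∃₂; ∃-syntax; _×_; _,_; proj₁; proj₂)
open import Data.Sum using (inj₁; inj₂)
open import Data.Empty using (⊥-elim)
open import Function using (_∘_; _∘′_; mk⇔)
open import Function.Definitions using (Injective)
open import Relation.Binary.PropositionalEquality
open import Relation.Binary.Definitions using (tri<; tri≈; tri>)
open import Relation.Nullary using (¬_; Dec; yes; no; does)
open import Relation.Nullary.Decidable using (dec-true; does-⇔)

∑ : ∀ n → (Fin n → ℕ) → ℕ
∑ zero    f = 0
∑ (suc n) f = f fzero + ∑ n (f ∘ fsuc)

∑-cong : ∀ n {f g : Fin n → ℕ} → (∀ i → f i ≡ g i) → ∑ n f ≡ ∑ n g
∑-cong zero    f≗g = refl
∑-cong (suc n) f≗g = cong₂ _+_ (f≗g fzero) (∑-cong n (f≗g ∘ fsuc))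

∑-distrib-+ : ∀ n (f g : Fin n → ℕ) → ∑ n (λ i → f i + g i) ≡ ∑ n f + ∑ n g
∑-distrib-+ zero    f g = refl
∑-distrib-+ (suc n) f g = begin
  f fzero + g fzero + ∑ n (λ i → f (fsuc i) + g (fsuc i))
    ≡⟨ cong (f fzero + g fzero +_) (∑-distrib-+ n (f ∘ fsuc) (g ∘ fsuc)) ⟩
  f fzero + g fzero + (∑ n (f ∘ fsuc) + ∑ n (g ∘ fsuc))
    ≡⟨ +-+-comm (f fzero) (g fzero) _ _ ⟩
  f fzero + ∑ n (f ∘ fsuc) + (g fzero + ∑ n (g ∘ fsuc)) ∎
  where
  open ≡-Reasoning
  +-+-comm : ∀ a b c d → a + b + (c + d) ≡ a + c + (b + d)
  +-+-comm = solve-∀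

*-distribˡ-∑ : ∀ n c (f : Fin n → ℕ) → c * ∑ n f ≡ ∑ n (λ i → c * f i)
*-distribˡ-∑ zero    c f = *-zeroʳ c
*-distribˡ-∑ (suc n) c f =
  trans (*-distribˡ-+ c (f fzero) _) (cong (c * f fzero +_) (*-distribˡ-∑ n c (f ∘ fsuc)))

∑-const : ∀ n c → ∑ n (λ _ → c) ≡ n * c
∑-const zero    c = refl
∑-const (suc n) c = cong (c +_) (∑-const n c)

∑≡0⇒≡0 : ∀ n (f : Fin n → ℕ) → ∑ n f ≡ 0 → ∀ i → f i ≡ 0
∑≡0⇒≡0 (suc n) f ∑≡0 fzero    = m+n≡0⇒m≡0 (f fzero) ∑≡0
∑≡0⇒≡0 (suc n) f ∑≡0 (fsuc i) = ∑≡0⇒≡0 n (f ∘ fsuc) (m+n≡0⇒n≡0 (f fzero) ∑≡0) i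

∑-mono-≤ : ∀ n {f g : Fin n → ℕ} → (∀ i → f i ≤ g i) → ∑ n f ≤ ∑ n g
∑-mono-≤ zero    f≤g = z≤n
∑-mono-≤ (suc n) f≤g = +-mono-≤ (f≤g fzero) (∑-mono-≤ n (f≤g ∘ fsuc))

∑-<-const : ∀ n {f : Fin n → ℕ} {c} → 0 < n → (∀ i → f i < c) → ∑ n f < n * c
∑-<-const (suc n) {f} {c} _ f<c =
  +-mono-<-≤ (f<c fzero) (≤-trans (∑-mono-≤ n (<⇒≤ ∘ f<c ∘ fsuc)) (≤-reflexive (∑-const n c)))

∑≤n*max : ∀ n (g : Fin (suc n) → ℕ) → ∃ λ r → ∑ (suc n) g ≤ suc n * g r
∑≤n*max zero    g = fzero , ≤-reflexive (trans (+-identityʳ (g fzero)) (sym (*-identityˡ (g fzero))))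
∑≤n*max (suc n) g with ∑≤n*max n (g ∘ fsuc)
... | r , ∑≤ with g fzero ≤? g (fsuc r)
...   | yes g₀≤gᵣ = fsuc r , +-mono-≤ g₀≤gᵣ ∑≤
...   | no  g₀≰gᵣ = fzero , +-monoʳ-≤ (g fzero) (≤-trans ∑≤ (*-monoʳ-≤ (suc n) (<⇒≤ (≰⇒> g₀≰gᵣ))))

∑-telescope : ∀ n (f : Fin (suc n) → ℕ) (δ : Fin n → ℕ) →
  (∀ j → f (fsuc j) ≡ f (inject₁ j) + δ j) → f (fromℕ n) ≡ f fzero + ∑ n δ
∑-telescope zero    f δ step = sym (+-identityʳ (f fzero))
∑-telescope (suc n) f δ step = begin
  f (fromℕ (suc n))                          ≡⟨ ∑-telescope n (f ∘ fsuc) (δ ∘ fsuc) (step ∘ fsuc) ⟩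
  f (fsuc fzero) + ∑ n (δ ∘ fsuc)            ≡⟨ cong (_+ ∑ n (δ ∘ fsuc)) (step fzero) ⟩
  f fzero + δ fzero + ∑ n (δ ∘ fsuc)         ≡⟨ +-assoc (f fzero) (δ fzero) _ ⟩
  f fzero + ∑ (suc n) δ                      ∎
  where open ≡-Reasoning

∏ : ∀ n → (Fin n → ℕ) → ℕ
∏ zero    f = 1
∏ (suc n) f = f fzero * ∏ n (f ∘ fsuc)

∏-const : ∀ n c → ∏ n (λ _ → c) ≡ c ^ n
∏-const zero    c = refl
∏-const (suc n) c = cong (c *_) (∏-const n c)

∏-update-≤ : ∀ n (c : Fin n) {x y z} → x * z ≤ y →
  ∏ n (λ i → if does (i Fin.≟ c) then x else y) * z ≤ y ^ n
∏-update-≤ (suc n) fzero {x} {y} {z} xz≤y = begin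
  x * ∏ n (λ _ → y) * z  ≡⟨ cong (λ p → x * p * z) (∏-const n y) ⟩
  x * y ^ n * z          ≡⟨ swap x (y ^ n) z ⟩
  x * z * y ^ n          ≤⟨ *-monoˡ-≤ (y ^ n) xz≤y ⟩
  y * y ^ n              ∎
  where
  open ≤-Reasoning
  swap : ∀ a b c → a * b * c ≡ a * c * b
  swap = solve-∀
∏-update-≤ (suc n) (fsuc c) {y = y} xz≤y =
  ≤-trans (≤-reflexive (*-assoc y _ _)) (*-monoʳ-≤ y (∏-update-≤ n c xz≤y))

digit-carry-< : ∀ B {a a′ b b′} → a < B → b < b′ → a + B * b < a′ + B * b′
digit-carry-< B {a} {a′} {b} {b′} a<B b<b′ = begin-strict
  a + B * b   <⟨ +-monoˡ-< (B * b) a<B ⟩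
  B + B * b   ≡⟨ *-suc B b ⟨
  B * suc b   ≤⟨ *-monoʳ-≤ B b<b′ ⟩
  B * b′      ≤⟨ m≤n+m (B * b′) a′ ⟩
  a′ + B * b′ ∎
  where open ≤-Reasoning

divMod-unique : ∀ B {a b a′ b′} → a < B → a′ < B → a + B * b ≡ a′ + B * b′ → a ≡ a′ × b ≡ b′
divMod-unique B {a} {b} {a′} {b′} a<B a′<B eq with <-cmp b b′
... | tri≈ _ refl _ = +-cancelʳ-≡ (B * b) a a′ eq , refl
... | tri< b<b′ _ _ = ⊥-elim (<-irrefl eq (digit-carry-< B a<B b<b′))
... | tri> _ _ b′<b = ⊥-elim (<-irrefl (sym eq) (digit-carry-< B a′<B b′<b))

∧≡true⇒ : ∀ {x y} → x ∧ y ≡ true → x ≡ true × y ≡ true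
∧≡true⇒ {true} {true} _ = refl , refl

does≡true⇒ : ∀ {P : Set} (P? : Dec P) → does P? ≡ true → P
does≡true⇒ (yes p) _ = p

divMod-digit : ∀ N .{{_ : NonZero N}} {q r} → r < N → (r + q * N) / N ≡ q × (r + q * N) % N ≡ r
divMod-digit N {q} {r} r<N with divMod-unique N (m%n<n x N) r<N (begin
    x % N + N * (x / N) ≡⟨ cong (x % N +_) (*-comm N (x / N)) ⟩
    x % N + x / N * N   ≡⟨ m≡m%n+[m/n]*n x N ⟨
    r + q * N           ≡⟨ cong (r +_) (*-comm q N) ⟩
    r + N * q           ∎)
  where
  open ≡-Reasoning
  x : ℕ
  x = r + q * N
... | rem≡ , quot≡ = quot≡ , rem≡

mixedRadix : ∀ n → (Fin n → ℕ) → (Fin n → ℕ) → ℕ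
mixedRadix zero    b c = 0
mixedRadix (suc n) b c = c fzero + b fzero * mixedRadix n (b ∘ fsuc) (c ∘ fsuc)

mixedRadix<∏ : ∀ n {b c : Fin n → ℕ} → (∀ i → c i < b i) → mixedRadix n b c < ∏ n b
mixedRadix<∏ zero    c<b = s≤s z≤n
mixedRadix<∏ (suc n) {b} {c} c<b =
  digit-carry-< (b fzero) {a′ = 0} (c<b fzero) (mixedRadix<∏ n (c<b ∘ fsuc))

mixedRadix-injective : ∀ n {b c c′ : Fin n → ℕ} → (∀ i → c i < b i) → (∀ i → c′ i < b i) →
  mixedRadix n b c ≡ mixedRadix n b c′ → ∀ i → c i ≡ c′ i
mixedRadix-injective (suc n) {b} c<b c′<b eq i
  with divMod-unique (b fzero) (c<b fzero) (c′<b fzero) eq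
mixedRadix-injective (suc n) c<b c′<b eq fzero    | head≡ , _ = head≡
mixedRadix-injective (suc n) c<b c′<b eq (fsuc i) | _ , tail≡ =
  mixedRadix-injective n (c<b ∘ fsuc) (c′<b ∘ fsuc) tail≡ i

line-through-two-points-< : ∀ {x x′ a a′ l₁ l₂} → l₁ < l₂ →
  x + l₁ * a ≡ x′ + l₁ * a′ → x + l₂ * a ≡ x′ + l₂ * a′ → x ≡ x′ × a ≡ a′
line-through-two-points-< {x} {x′} {a} {a′} {l₁} l₁<l₂ at-l₁ at-l₂ with m≤n⇒∃[o]m+o≡n l₁<l₂
... | o , refl = +-cancelʳ-≡ (l₁ * a) x x′ (trans at-l₁ (cong (λ z → x′ + l₁ * z) (sym a≡a′))) , a≡a′
  where
  split : ∀ x l o a → x + suc (l + o) * a ≡ x + l * a + suc o * a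
  split = solve-∀
  a≡a′ : a ≡ a′
  a≡a′ = *-cancelˡ-≡ a a′ (suc o) (+-cancelˡ-≡ (x′ + l₁ * a′) _ _ (begin
    x′ + l₁ * a′ + suc o * a  ≡⟨ cong (_+ suc o * a) at-l₁ ⟨
    x + l₁ * a + suc o * a    ≡⟨ split x l₁ o a ⟨
    x + suc (l₁ + o) * a      ≡⟨ at-l₂ ⟩
    x′ + suc (l₁ + o) * a′    ≡⟨ split x′ l₁ o a′ ⟩
    x′ + l₁ * a′ + suc o * a′ ∎))
    where open ≡-Reasoning

line-through-two-points : ∀ {x x′ a a′ l₁ l₂} → l₁ ≢ l₂ →
  x + l₁ * a ≡ x′ + l₁ * a′ → x + l₂ * a ≡ x′ + l₂ * a′ → x ≡ x′ × a ≡ a′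
line-through-two-points {l₁ = l₁} {l₂} l₁≢l₂ at-l₁ at-l₂ with <-cmp l₁ l₂
... | tri< l₁<l₂ _ _ = line-through-two-points-< l₁<l₂ at-l₁ at-l₂
... | tri≈ _ l₁≡l₂ _ = ⊥-elim (l₁≢l₂ l₁≡l₂)
... | tri> _ _ l₂<l₁ = line-through-two-points-< l₂<l₁ at-l₂ at-l₁

consecutive-label-step : ∀ y y′ l w → y′ + l * w ≡ y + suc l * w → y′ ≡ y + w
consecutive-label-step y y′ l w eq = +-cancelʳ-≡ (l * w) _ _ (trans eq (regroup y l w))
  where
  regroup : ∀ y l w → y + suc l * w ≡ y + w + l * w
  regroup = solve-∀

threshold : ∀ {P : ℕ → Set} → (∀ e → Dec (P e)) → ∀ a N → P a → ¬ P (a + N) →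
  ∃ λ e → a ≤ e × P e × ¬ P (suc e)
threshold {P} P? a zero    Pa ¬Pa+0 = ⊥-elim (¬Pa+0 (subst P (sym (+-identityʳ a)) Pa))
threshold {P} P? a (suc N) Pa ¬Pa+N with P? (suc a)
... | no ¬Pa+1 = a , ≤-refl , Pa , ¬Pa+1
... | yes Pa+1 with threshold P? (suc a) N Pa+1 (subst (¬_ ∘ P) (+-suc a N) ¬Pa+N)
...   | e , a<e , Pe , ¬Pe+1 = e , <⇒≤ a<e , Pe , ¬Pe+1

-- Average-free sets after Behrend

square-expansion : ∀ x z → x * x + z * z ≡ 2 * (x * z) + ∣ x - z ∣ * ∣ x - z ∣
square-expansion x z with ≤-total x z
... | inj₁ x≤z with m≤n⇒∃[o]m+o≡n x≤z
...   | o , refl rewrite ∣m-m+n∣≡n x o = expand x o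
  where
  expand : ∀ x o → x * x + (x + o) * (x + o) ≡ 2 * (x * (x + o)) + o * o
  expand = solve-∀
square-expansion x z | inj₂ z≤x with m≤n⇒∃[o]m+o≡n z≤x
...   | o , refl rewrite ∣-∣-comm (z + o) z | ∣m-m+n∣≡n z o = expand z o
  where
  expand : ∀ z o → (z + o) * (z + o) + z * z ≡ 2 * ((z + o) * z) + o * o
  expand = solve-∀

∑-square-expansion : ∀ K (x : Fin K → ℕ) z → ∑ K x ≡ K * z →
  ∑ K (λ j → x j * x j) + K * (z * z) ≡ 2 * (K * (z * z)) + ∑ K (λ j → ∣ x j - z ∣ * ∣ x j - z ∣)
∑-square-expansion K x z ∑x≡Kz = begin
  ∑ K (λ j → x j * x j) + K * (z * z)
    ≡⟨ cong (∑ K (λ j → x j * x j) +_) (∑-const K (z * z)) ⟨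
  ∑ K (λ j → x j * x j) + ∑ K (λ _ → z * z)
    ≡⟨ ∑-distrib-+ K _ _ ⟨
  ∑ K (λ j → x j * x j + z * z)
    ≡⟨ ∑-cong K (λ j → square-expansion (x j) z) ⟩
  ∑ K (λ j → 2 * (x j * z) + d² j)
    ≡⟨ ∑-distrib-+ K _ _ ⟩
  ∑ K (λ j → 2 * (x j * z)) + ∑ K d²
    ≡⟨ cong (_+ ∑ K d²) cross-term ⟩
  2 * (K * (z * z)) + ∑ K d² ∎
  where
  open ≡-Reasoning
  d² : Fin K → ℕ
  d² j = ∣ x j - z ∣ * ∣ x j - z ∣
  rearrange : ∀ z K → 2 * (z * (K * z)) ≡ 2 * (K * (z * z))
  rearrange = solve-∀
  cross-term : ∑ K (λ j → 2 * (x j * z)) ≡ 2 * (K * (z * z))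
  cross-term = begin
    ∑ K (λ j → 2 * (x j * z))  ≡⟨ ∑-cong K (λ j → cong (2 *_) (*-comm (x j) z)) ⟩
    ∑ K (λ j → 2 * (z * x j))  ≡⟨ *-distribˡ-∑ K 2 _ ⟨
    2 * ∑ K (λ j → z * x j)    ≡⟨ cong (2 *_) (*-distribˡ-∑ K z x) ⟨
    2 * (z * ∑ K x)            ≡⟨ cong (λ s → 2 * (z * s)) ∑x≡Kz ⟩
    2 * (z * (K * z))          ≡⟨ rearrange z K ⟩
    2 * (K * (z * z))          ∎

module Digits (d B : ℕ) where

  value : ∀ {D} → Vec (Fin d) D → ℕ
  value {zero}  _ = 0
  value {suc D} w = toℕ (head w) + B * value (tail w)

  norm² : ∀ {D} → Vec (Fin d) D → ℕ
  norm² {zero}  _ = 0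
  norm² {suc D} w = toℕ (head w) * toℕ (head w) + norm² (tail w)

  dist² : ∀ {D} → Vec (Fin d) D → Vec (Fin d) D → ℕ
  dist² {zero}  _ _ = 0
  dist² {suc D} u w = ∣ toℕ (head u) - toℕ (head w) ∣ * ∣ toℕ (head u) - toℕ (head w) ∣ + dist² (tail u) (tail w)

  dist²≡0⇒≡ : ∀ {D} (u w : Vec (Fin d) D) → dist² u w ≡ 0 → u ≡ w
  dist²≡0⇒≡ []      []      _    = refl
  dist²≡0⇒≡ (x ∷ u) (z ∷ w) d²≡0 = cong₂ _∷_
    (toℕ-injective (∣m-n∣≡0⇒m≡n (m*m≡0⇒m≡0 (m+n≡0⇒m≡0 _ d²≡0))))
    (dist²≡0⇒≡ u w (m+n≡0⇒n≡0 _ d²≡0))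
    where
    m*m≡0⇒m≡0 : ∀ {m} → m * m ≡ 0 → m ≡ 0
    m*m≡0⇒m≡0 {zero} _ = refl

  module _ {K} (0<K : 0 < K) (Kd≤B : K * d ≤ B) where

    -- The digit sums stay below the base, so adding the K values produces no carries.
    carry-free : ∀ {D} (α : Fin K → Vec (Fin d) (suc D)) (c : Vec (Fin d) (suc D)) →
      ∑ K (value ∘ α) ≡ K * value c →
      ∑ K (λ j → toℕ (head (α j))) ≡ K * toℕ (head c) × ∑ K (λ j → value (tail (α j))) ≡ K * value (tail c)
    carry-free α c ∑α≡Kc = divMod-unique B
      (<-≤-trans (∑-<-const K 0<K (λ j → toℕ<n (head (α j)))) Kd≤B)
      (<-≤-trans (*-monoʳ-< K ⦃ >-nonZero 0<K ⦄ (toℕ<n (head c))) Kd≤B)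
      (begin
        ∑ K (λ j → toℕ (head (α j))) + B * ∑ K (λ j → value (tail (α j)))
          ≡⟨ cong (∑ K (λ j → toℕ (head (α j))) +_) (*-distribˡ-∑ K B _) ⟩
        ∑ K (λ j → toℕ (head (α j))) + ∑ K (λ j → B * value (tail (α j)))
          ≡⟨ ∑-distrib-+ K _ _ ⟨
        ∑ K (value ∘ α)
          ≡⟨ ∑α≡Kc ⟩
        K * value c
          ≡⟨ distribute K (toℕ (head c)) B (value (tail c)) ⟩
        K * toℕ (head c) + B * (K * value (tail c)) ∎)
      where
      open ≡-Reasoning
      distribute : ∀ K z B v → K * (z + B * v) ≡ K * z + B * (K * v)
      distribute = solve-∀

    ∑-norm²-expansion : ∀ {D} (α : Fin K → Vec (Fin d) D) (c : Vec (Fin d) D) → ∑ K (value ∘ α) ≡ K * value c →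
      ∑ K (norm² ∘ α) + K * norm² c ≡ 2 * (K * norm² c) + ∑ K (λ j → dist² (α j) c)
    ∑-norm²-expansion {zero} α c _ = begin
      ∑ K (λ _ → 0) + K * 0           ≡⟨ cong (_+ K * 0) (∑-const K 0) ⟩
      K * 0 + K * 0                   ≡⟨ vanish K ⟩
      2 * (K * 0) + K * 0             ≡⟨ cong (2 * (K * 0) +_) (∑-const K 0) ⟨
      2 * (K * 0) + ∑ K (λ _ → 0)     ∎
      where
      open ≡-Reasoning
      vanish : ∀ K → K * 0 + K * 0 ≡ 2 * (K * 0) + K * 0
      vanish = solve-∀
    ∑-norm²-expansion {suc D} α c ∑α≡Kc = begin
      ∑ K (λ j → x j * x j + norm² (tail (α j))) + K * (z * z + norm² (tail c))
        ≡⟨ cong (_+ K * (z * z + norm² (tail c))) (∑-distrib-+ K _ _) ⟩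
      ∑ K (λ j → x j * x j) + ∑ K (λ j → norm² (tail (α j))) + K * (z * z + norm² (tail c))
        ≡⟨ regroup (∑ K (λ j → x j * x j)) _ K (z * z) (norm² (tail c)) ⟩
      (∑ K (λ j → x j * x j) + K * (z * z)) + (∑ K (λ j → norm² (tail (α j))) + K * norm² (tail c))
        ≡⟨ cong₂ _+_ (∑-square-expansion K x z heads) (∑-norm²-expansion (tail ∘ α) (tail c) tails) ⟩
      (2 * (K * (z * z)) + ∑ K (λ j → ∣ x j - z ∣ * ∣ x j - z ∣))
        + (2 * (K * norm² (tail c)) + ∑ K (λ j → dist² (tail (α j)) (tail c)))
        ≡⟨ regroup′ K (z * z) (norm² (tail c)) _ _ ⟩
      2 * (K * (z * z + norm² (tail c)))
        + (∑ K (λ j → ∣ x j - z ∣ * ∣ x j - z ∣) + ∑ K (λ j → dist² (tail (α j)) (tail c)))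
        ≡⟨ cong (2 * (K * (z * z + norm² (tail c))) +_) (∑-distrib-+ K _ _) ⟨
      2 * (K * norm² c) + ∑ K (λ j → dist² (α j) c) ∎
      where
      open ≡-Reasoning
      x : Fin K → ℕ
      x j = toℕ (head (α j))
      z : ℕ
      z = toℕ (head c)
      heads : ∑ K (λ j → toℕ (head (α j))) ≡ K * toℕ (head c)
      heads = proj₁ (carry-free α c ∑α≡Kc)
      tails : ∑ K (λ j → value (tail (α j))) ≡ K * value (tail c)
      tails = proj₂ (carry-free α c ∑α≡Kc)
      regroup : ∀ a b K s n → a + b + K * (s + n) ≡ (a + K * s) + (b + K * n)
      regroup = solve-∀
      regroup′ : ∀ K s n p q → (2 * (K * s) + p) + (2 * (K * n) + q) ≡ 2 * (K * (s + n)) + (p + q)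
      regroup′ = solve-∀

    equal-norm-average-trivial : ∀ {D} r (α : Fin K → Vec (Fin d) D) (c : Vec (Fin d) D) →
      (∀ j → norm² (α j) ≡ r) → norm² c ≡ r → ∑ K (value ∘ α) ≡ K * value c → ∀ j → α j ≡ c
    equal-norm-average-trivial r α c α-on-sphere c-on-sphere ∑α≡Kc j =
      dist²≡0⇒≡ (α j) c (∑≡0⇒≡0 K (λ j → dist² (α j) c) ∑dist²≡0 j)
      where
      open ≡-Reasoning
      ∑dist²≡0 : ∑ K (λ j → dist² (α j) c) ≡ 0
      ∑dist²≡0 = +-cancelˡ-≡ (2 * (K * r)) _ 0 (begin
        2 * (K * r) + ∑ K (λ j → dist² (α j) c)       ≡⟨ cong (λ s → 2 * (K * s) + _) c-on-sphere ⟨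
        2 * (K * norm² c) + ∑ K (λ j → dist² (α j) c) ≡⟨ ∑-norm²-expansion α c ∑α≡Kc ⟨
        ∑ K (norm² ∘ α) + K * norm² c                 ≡⟨ cong₂ _+_ (trans (∑-cong K α-on-sphere) (∑-const K r)) (cong (K *_) c-on-sphere) ⟩
        K * r + K * r                                 ≡⟨ double (K * r) ⟩
        2 * (K * r) + 0                               ∎)
        where
        double : ∀ x → x + x ≡ 2 * x + 0
        double = solve-∀

length-cartesianProductWith : ∀ {A B C : Set} (f : A → B → C) (xs : List A) (ys : List B) →
  length (cartesianProductWith f xs ys) ≡ length xs * length ys
length-cartesianProductWith f []       ys = refl
length-cartesianProductWith f (x ∷ xs) ys =
  trans (length-++ (map (f x) ys)) (cong₂ _+_ (length-map (f x) ys) (length-cartesianProductWith f xs ys))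

length-allFin : ∀ n → length (allFin n) ≡ n
length-allFin n = length-tabulate {n = n} (λ i → i)

AllPairs-lookup : ∀ {A : Set} {R : A → A → Set} {xs : List A} → AllPairs R xs →
  ∀ {i j : Fin (length xs)} → toℕ i < toℕ j → R (lookup xs i) (lookup xs j)
AllPairs-lookup {R = R} {x ∷ xs} (x-R-xs ∷ _) {fzero} {fsuc j} _ = All-lookup x-R-xs j
  where
  All-lookup : ∀ {ys} → All (R x) ys → ∀ j → R x (lookup ys j)
  All-lookup (r ∷ _)  fzero    = r
  All-lookup (_ ∷ rs) (fsuc j) = All-lookup rs j
AllPairs-lookup (_ ∷ xs!) {fsuc i} {fsuc j} (s≤s i<j) = AllPairs-lookup xs! i<j

lookup-injective : ∀ {A : Set} {xs : List A} → Unique xs → Injective _≡_ _≡_ (lookup xs)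
lookup-injective xs! {i} {j} eq with <-cmp (toℕ i) (toℕ j)
... | tri< i<j _ _ = ⊥-elim (AllPairs-lookup xs! i<j eq)
... | tri≈ _ i≡j _ = toℕ-injective i≡j
... | tri> _ _ j<i = ⊥-elim (AllPairs-lookup xs! j<i (sym eq))

length-≤-via-code : ∀ {A : Set} {R : A → A → Set} (code : A → ℕ) N → (∀ a → code a < N) →
  (∀ a b → code a ≡ code b → ¬ R a b) → ∀ xs → AllPairs R xs → length xs ≤ N
length-≤-via-code code N code<N code-separates xs xs! with length xs ≤? N
... | yes ≤N = ≤N
... | no ≰N with pigeonhole (≰⇒> ≰N) (λ i → fromℕ< (code<N (lookup xs i)))
...   | i , j , i<j , same = ⊥-elim (code-separates _ _ same-code (AllPairs-lookup xs! i<j))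
  where
  same-code : code (lookup xs i) ≡ code (lookup xs j)
  same-code = trans (sym (toℕ-fromℕ< _)) (trans (cong toℕ same) (toℕ-fromℕ< _))

module _ {A : Set} (f : A → ℕ) where

  fibre : ℕ → List A → List A
  fibre r = filter (λ a → f a ≟ r)

  length-fibre-∷ : ∀ r x xs → length (fibre r (x ∷ xs)) ≡ (if does (f x ≟ r) then 1 else 0) + length (fibre r xs)
  length-fibre-∷ r x xs with does (f x ≟ r)
  ... | true  = refl
  ... | false = refl

  ∑-length-fibre : ∀ R (xs : List A) → (∀ a → f a < R) → ∑ R (λ r → length (fibre (toℕ r) xs)) ≡ length xs
  ∑-length-fibre R []       f<R = trans (∑-const R 0) (*-zeroʳ R)
  ∑-length-fibre R (x ∷ xs) f<R = begin
    ∑ R (λ r → length (fibre (toℕ r) (x ∷ xs)))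
      ≡⟨ ∑-cong R (λ r → length-fibre-∷ (toℕ r) x xs) ⟩
    ∑ R (λ r → (if does (f x ≟ toℕ r) then 1 else 0) + length (fibre (toℕ r) xs))
      ≡⟨ ∑-distrib-+ R _ _ ⟩
    ∑ R (λ r → if does (f x ≟ toℕ r) then 1 else 0) + ∑ R (λ r → length (fibre (toℕ r) xs))
      ≡⟨ cong₂ _+_ (∑-indicator R (f<R x)) (∑-length-fibre R xs f<R) ⟩
    suc (length xs) ∎
    where
    open ≡-Reasoning
    ∑-indicator : ∀ R {v} → v < R → ∑ R (λ r → if does (v ≟ toℕ r) then 1 else 0) ≡ 1
    ∑-indicator (suc R) {zero}  _         = cong suc (trans (∑-const R 0) (*-zeroʳ R))
    ∑-indicator (suc R) {suc v} (s≤s v<R) = ∑-indicator R v<R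

  popular-value : ∀ R (xs : List A) → (∀ a → f a < suc R) → ∃ λ r → length xs ≤ suc R * length (fibre r xs)
  popular-value R xs f≤R with ∑≤n*max R (λ r → length (fibre (toℕ r) xs))
  ... | r , ∑≤ = toℕ r , subst (_≤ suc R * length (fibre (toℕ r) xs)) (∑-length-fibre (suc R) xs f≤R) ∑≤

allVectors : ∀ d D → List (Vec (Fin d) D)
allVectors d zero    = [] ∷ []
allVectors d (suc D) = cartesianProductWith _∷_ (allFin d) (allVectors d D)

length-allVectors : ∀ d D → length (allVectors d D) ≡ d ^ D
length-allVectors d zero    = refl
length-allVectors d (suc D) = trans (length-cartesianProductWith _∷_ (allFin d) (allVectors d D))
  (cong₂ _*_ (length-allFin d) (length-allVectors d D))

allVectors-unique : ∀ d D → Unique (allVectors d D)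
allVectors-unique d zero    = [] ∷ []
allVectors-unique d (suc D) = Unique.cartesianProductWith⁺ _∷_ ∷-injective (Unique.allFin⁺ d) (allVectors-unique d D)

AverageFree : ∀ {s} → ℕ → (Fin s → ℕ) → Set
AverageFree {s} K a = ∀ (α : Fin K → Fin s) c → ∑ K (a ∘ α) ≡ K * a c → ∀ j → α j ≡ c

AverageFree⇒injective : ∀ {K s} {a : Fin s → ℕ} → 0 < K → AverageFree K a → Injective _≡_ _≡_ a
AverageFree⇒injective {suc K} {a = a} _ free {i} {c} aᵢ≡a꜀ =
  free (λ _ → i) c (trans (∑-const (suc K) (a i)) (cong (suc K *_) aᵢ≡a꜀)) fzero

cycle-steps-constant : ∀ {L s} {a : Fin s → ℕ} → AverageFree L a →
  (Y : Fin (suc L) → ℕ) (w : Fin L → Fin s) (c : Fin s) →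
  (∀ j → Y (fsuc j) ≡ Y (inject₁ j) + a (w j)) → Y fzero + L * a c ≡ Y (fromℕ L) → ∀ j → w j ≡ c
cycle-steps-constant {L} {a = a} free Y w c step close = free w c
  (+-cancelˡ-≡ (Y fzero) _ _ (trans (sym (∑-telescope L Y (a ∘ w) step)) (sym close)))

behrend : ∀ {K} d D → 0 < K →
  ∃₂ λ s (a : Fin s → ℕ) → (∀ i → a i < (K * d) ^ D) × AverageFree K a × d ^ D ≤ suc (D * (d * d)) * s
behrend {K} d D 0<K = length sphere , value ∘ lookup sphere , value< ∘ lookup sphere , average-free , popular
  where
  open Digits d (K * d)

  d≤Kd : d ≤ K * d
  d≤Kd = m≤n*m d K ⦃ >-nonZero 0<K ⦄

  value< : ∀ {D} (w : Vec (Fin d) D) → value w < (K * d) ^ D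
  value< []      = s≤s z≤n
  value< (x ∷ w) = digit-carry-< (K * d) {a′ = 0} (<-≤-trans (toℕ<n x) d≤Kd) (value< w)

  norm²≤ : ∀ {D} (w : Vec (Fin d) D) → norm² w ≤ D * (d * d)
  norm²≤ []      = z≤n
  norm²≤ (x ∷ w) = +-mono-≤ (*-mono-≤ (<⇒≤ (toℕ<n x)) (<⇒≤ (toℕ<n x))) (norm²≤ w)

  radius : ∃ λ r → length (allVectors d D) ≤ suc (D * (d * d)) * length (fibre norm² r (allVectors d D))
  radius = popular-value norm² (D * (d * d)) (allVectors d D) (s≤s ∘ norm²≤)

  r : ℕ
  r = proj₁ radius

  sphere : List (Vec (Fin d) D)
  sphere = fibre norm² r (allVectors d D)

  popular : d ^ D ≤ suc (D * (d * d)) * length sphere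
  popular = subst (_≤ suc (D * (d * d)) * length sphere) (length-allVectors d D) (proj₂ radius)

  on-sphere : ∀ i → norm² (lookup sphere i) ≡ r
  on-sphere i = proj₂ (∈-filter⁻ (λ w → norm² w ≟ r) {xs = allVectors d D} (∈-lookup i))

  average-free : AverageFree K (value ∘ lookup sphere)
  average-free α c ∑≡Kc j =
    lookup-injective (Unique.filter⁺ (λ w → norm² w ≟ r) (allVectors-unique d D))
      (equal-norm-average-trivial 0<K ≤-refl r (lookup sphere ∘ α) (lookup sphere c)
        (on-sphere ∘ α) (on-sphere c) ∑≡Kc j)

-- The construction

module Construction
  {k₀} (K : OGraph (suc k₀)) (K-core : IsCore K)
  {m} (v : Fin (3 + m) → Fin (suc k₀)) (v-injective : Injective _≡_ _≡_ v)
  (v-path : ∀ i j → toℕ j ≡ suc (toℕ i) → Edge K (v i) (v j))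
  (v-close : Edge K (v (fromℕ (2 + m))) (v fzero))
  {s} (a : Fin s → ℕ) (M : ℕ) ⦃ _ : NonZero M ⦄ (a<M : ∀ w → a w < M) (a-free : AverageFree (2 + m) a)
  (t : ℕ) ⦃ _ : NonZero t ⦄
  where

  k Λ H T P : ℕ
  k = suc k₀
  Λ = 3 + m + k
  H = suc Λ * M
  T = suc k * t
  P = H * T

  instance
    T-nonZero : NonZero T
    T-nonZero = m*n≢0 (suc k) t
    P-nonZero : NonZero P
    P-nonZero = m*n≢0 H T ⦃ m*n≢0 (suc Λ) M ⦄

  opaque
    label : Fin k → ℕ
    label i with any? (λ j → v j Fin.≟ i)
    ... | yes (j , _) = toℕ j
    ... | no _        = 3 + m + toℕ i

    label-cycle : ∀ j → label (v j) ≡ toℕ j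
    label-cycle j with any? (λ j′ → v j′ Fin.≟ v j)
    ... | yes (j′ , vj′≡vj) = cong toℕ (v-injective vj′≡vj)
    ... | no ∄j             = ⊥-elim (∄j (j , refl))

    label< : ∀ i → label i < Λ
    label< i with any? (λ j → v j Fin.≟ i)
    ... | yes (j , _) = <-≤-trans (toℕ<n j) (m≤m+n (3 + m) k)
    ... | no _        = +-monoʳ-< (3 + m) (toℕ<n i)

    label-injective : Injective _≡_ _≡_ label
    label-injective {i} {i′} eq with any? (λ j → v j Fin.≟ i) | any? (λ j → v j Fin.≟ i′)
    ... | yes (j , refl) | yes (j′ , refl) = cong v (toℕ-injective eq)
    ... | yes (j , _)    | no _            = ⊥-elim (<-irrefl eq (<-≤-trans (toℕ<n j) (m≤m+n (3 + m) (toℕ i′))))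
    ... | no _           | yes (j′ , _)    = ⊥-elim (<-irrefl (sym eq) (<-≤-trans (toℕ<n j′) (m≤m+n (3 + m) (toℕ i))))
    ... | no _           | no _            = toℕ-injective (+-cancelˡ-≡ (3 + m) _ _ eq)

  -- A position x encodes slot x + height x · T + part x · P; positions ≥ k · P all fall into the
  -- last part.  These, like label and linked, are opaque: unfolding them during unification
  -- is prohibitively slow.
  opaque
    part : ℕ → Fin k
    part x = fromℕ< (s≤s (m⊓n≤n (x / P) k₀))

    rest : ℕ → ℕ
    rest x = x ∸ toℕ (part x) * P

    height : ℕ → ℕ
    height x = rest x / T

    slot : ℕ → ℕ
    slot x = rest x % T

    slot<T : ∀ x → slot x < T
    slot<T x = m%n<n (rest x) T

    part-mono-≤ : ∀ {x y} → x ≤ y → toℕ (part x) ≤ toℕ (part y)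
    part-mono-≤ {x} {y} x≤y = subst₂ _≤_ (sym (toℕ-fromℕ< _)) (sym (toℕ-fromℕ< _)) (⊓-monoˡ-≤ k₀ (/-monoˡ-≤ P x≤y))

    decompose : ∀ x → x ≡ slot x + height x * T + toℕ (part x) * P
    decompose x = begin
      x                                        ≡⟨ m∸n+n≡m part*P≤x ⟨
      rest x + toℕ (part x) * P                ≡⟨ cong (_+ toℕ (part x) * P) (m≡m%n+[m/n]*n (rest x) T) ⟩
      slot x + height x * T + toℕ (part x) * P ∎
      where
      open ≡-Reasoning
      part*P≤x : toℕ (part x) * P ≤ x
      part*P≤x = ≤-trans (*-monoˡ-≤ P (≤-trans (≤-reflexive (toℕ-fromℕ< _)) (m⊓n≤m (x / P) k₀))) (m/n*n≤m x P)

    decode : ∀ i {y z} → z < T → z + y * T < P →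
      let x = z + y * T + toℕ i * P in part x ≡ i × height x ≡ y × slot x ≡ z
    decode i {y} {z} z<T r<P = part≡
      , trans (cong (_/ T) rest≡) (proj₁ (divMod-digit T {y} z<T))
      , trans (cong (_% T) rest≡) (proj₂ (divMod-digit T {y} z<T))
      where
      open ≡-Reasoning
      r : ℕ
      r = z + y * T
      part≡ : part (r + toℕ i * P) ≡ i
      part≡ = toℕ-injective (begin
        toℕ (part (r + toℕ i * P)) ≡⟨ toℕ-fromℕ< _ ⟩
        (r + toℕ i * P) / P ⊓ k₀   ≡⟨ cong (_⊓ k₀) (proj₁ (divMod-digit P r<P)) ⟩
        toℕ i ⊓ k₀                 ≡⟨ m≤n⇒m⊓n≡m (s≤s⁻¹ (toℕ<n i)) ⟩
        toℕ i                      ∎)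
      rest≡ : rest (r + toℕ i * P) ≡ r
      rest≡ = trans (cong (λ j → r + toℕ i * P ∸ toℕ j * P) part≡) (m+n∸n≡m r (toℕ i * P))

  same-vertex : ∀ {x y} → part x ≡ part y → height x ≡ height y → slot x ≡ slot y → x ≡ y
  same-vertex {x} {y} same-part same-height same-slot = begin
    x                                        ≡⟨ decompose x ⟩
    slot x + height x * T + toℕ (part x) * P ≡⟨ cong₂ (λ r i → r + toℕ i * P) (cong₂ (λ s h → s + h * T) same-slot same-height) same-part ⟩
    slot y + height y * T + toℕ (part y) * P ≡⟨ decompose y ⟨
    y                                        ∎
    where open ≡-Reasoning

  -- z − y = (label j − label i) · a w, with both sides moved so that no subtraction occurs.
  Aligned : Fin k → ℕ → Fin k → ℕ → Fin s → Set
  Aligned i y j z w = z + label i * a w ≡ y + label j * a w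

  opaque
    linked : Fin k → ℕ → Fin k → ℕ → Bool
    linked i y j z = adj K i j ∧ does (any? (λ w → z + label i * a w ≟ y + label j * a w))

    linked-sym : ∀ i y j z → linked i y j z ≡ linked j z i y
    linked-sym i y j z = cong₂ _∧_ (OGraph.sym K i j)
      (does-⇔ (mk⇔ (flip i y j z) (flip j z i y)) (any? (λ w → _ ≟ _)) (any? (λ w → _ ≟ _)))
      where
      flip : ∀ i y j z → ∃ (Aligned i y j z) → ∃ (Aligned j z i y)
      flip _ _ _ _ (w , aligned) = w , sym aligned

    linked-irrefl : ∀ i y → linked i y i y ≡ false
    linked-irrefl i y rewrite OGraph.irref K i = refl

    linked⇒ : ∀ {i y j z} → linked i y j z ≡ true → Edge K i j × ∃ (Aligned i y j z)
    linked⇒ e with ∧≡true⇒ e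
    ... | K-edge , aligned = K-edge , does≡true⇒ (any? (λ w → _ ≟ _)) aligned

    aligned⇒linked≡adj : ∀ {i y j z w} → Aligned i y j z w → linked i y j z ≡ adj K i j
    aligned⇒linked≡adj {i} {y} {j} {z} {w} aligned =
      trans (cong (adj K i j ∧_) (dec-true (any? (λ w → _ ≟ _)) (w , aligned))) (∧-identityʳ _)

  linkedAt : ℕ → ℕ → Bool
  linkedAt x y = linked (part x) (height x) (part y) (height y)

  G : ∀ n → OGraph n
  G n = record
    { adj   = λ p q → linkedAt (toℕ p) (toℕ q)
    ; sym   = λ p q → linked-sym _ _ _ _
    ; irref = λ p → linked-irrefl (part (toℕ p)) (height (toℕ p))
    }

  edge-aligned : ∀ {n} {p q : Fin n} → Edge (G n) p q →
    Edge K (part (toℕ p)) (part (toℕ q)) × ∃ (Aligned (part (toℕ p)) (height (toℕ p)) (part (toℕ q)) (height (toℕ q)))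
  edge-aligned = linked⇒

  part-hom : ∀ n → IsHom (G n) K (part ∘ toℕ)
  part-hom n = (λ _ _ → part-mono-≤) , (λ _ _ → proj₁ ∘ edge-aligned)

  Tuple : Set
  Tuple = Fin M × Fin s × Fin t × Fin t

  heightAt : Tuple → Fin k → ℕ
  heightAt (x , w , _) i = toℕ x + label i * a w

  slotAt : Tuple → Fin k → ℕ
  slotAt (_ , _ , u , y) i = toℕ u + toℕ i * toℕ y

  restAt : Tuple → Fin k → ℕ
  restAt τ i = slotAt τ i + heightAt τ i * T

  positionAt : Tuple → Fin k → ℕ
  positionAt τ i = restAt τ i + toℕ i * P

  slotAt<T : ∀ τ i → slotAt τ i < T
  slotAt<T (_ , _ , u , y) i = +-mono-<-≤ (toℕ<n u) (*-mono-≤ (<⇒≤ (toℕ<n i)) (<⇒≤ (toℕ<n y)))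

  heightAt<H : ∀ τ i → heightAt τ i < H
  heightAt<H (x , w , _) i = +-mono-<-≤ (toℕ<n x) (*-mono-≤ (<⇒≤ (label< i)) (<⇒≤ (a<M w)))

  restAt<P : ∀ τ i → restAt τ i < P
  restAt<P τ i = <-≤-trans (+-monoˡ-< (heightAt τ i * T) (slotAt<T τ i)) (*-monoˡ-≤ T (heightAt<H τ i))

  positionAt<kP : ∀ τ i → positionAt τ i < k * P
  positionAt<kP τ i = <-≤-trans (+-monoˡ-< (toℕ i * P) (restAt<P τ i)) (*-monoˡ-≤ P (toℕ<n i))

  part-positionAt : ∀ τ i → part (positionAt τ i) ≡ i
  part-positionAt τ i = proj₁ (decode i {heightAt τ i} (slotAt<T τ i) (restAt<P τ i))

  height-positionAt : ∀ τ i → height (positionAt τ i) ≡ heightAt τ i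
  height-positionAt τ i = proj₁ (proj₂ (decode i {heightAt τ i} (slotAt<T τ i) (restAt<P τ i)))

  slot-positionAt : ∀ τ i → slot (positionAt τ i) ≡ slotAt τ i
  slot-positionAt τ i = proj₂ (proj₂ (decode i {heightAt τ i} (slotAt<T τ i) (restAt<P τ i)))

  same-positionAt⇒same-heightAt : ∀ {τ σ i} → positionAt τ i ≡ positionAt σ i → heightAt τ i ≡ heightAt σ i
  same-positionAt⇒same-heightAt {τ} {σ} {i} same =
    trans (sym (height-positionAt τ i)) (trans (cong height same) (height-positionAt σ i))

  same-positionAt⇒same-slotAt : ∀ {τ σ i} → positionAt τ i ≡ positionAt σ i → slotAt τ i ≡ slotAt σ i
  same-positionAt⇒same-slotAt {τ} {σ} {i} same =
    trans (sym (slot-positionAt τ i)) (trans (cong slot same) (slot-positionAt σ i))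

  positionAt-injective : ∀ {τ σ i j} → i ≢ j →
    positionAt τ i ≡ positionAt σ i → positionAt τ j ≡ positionAt σ j → τ ≡ σ
  positionAt-injective {τ} {σ} i≢j same-i same-j
    with line-through-two-points (i≢j ∘ label-injective)
           (same-positionAt⇒same-heightAt {τ} {σ} same-i) (same-positionAt⇒same-heightAt {τ} {σ} same-j)
       | line-through-two-points (i≢j ∘ toℕ-injective)
           (same-positionAt⇒same-slotAt {τ} {σ} same-i) (same-positionAt⇒same-slotAt {τ} {σ} same-j)
  ... | x≡x′ , aw≡aw′ | u≡u′ , y≡y′ =
    cong₂ _,_ (toℕ-injective x≡x′) (cong₂ _,_ (AverageFree⇒injective (s≤s z≤n) a-free aw≡aw′)
      (cong₂ _,_ (toℕ-injective u≡u′) (toℕ-injective y≡y′)))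

  linkedAt-positionAt : ∀ τ i j → linkedAt (positionAt τ i) (positionAt τ j) ≡ adj K i j
  linkedAt-positionAt τ@(x , w , _) i j = trans
    (cong₂ (λ (p q : Fin k × ℕ) → linked (proj₁ p) (proj₂ p) (proj₁ q) (proj₂ q))
      (cong₂ _,_ (part-positionAt τ i) (height-positionAt τ i)) (cong₂ _,_ (part-positionAt τ j) (height-positionAt τ j)))
    (aligned⇒linked≡adj (exchange (toℕ x) (label i) (label j) (a w)))
    where
    exchange : ∀ x p q r → x + q * r + p * r ≡ x + p * r + q * r
    exchange = solve-∀

  module Planted {n} (kP≤n : k * P ≤ n) where

    embed : Tuple → Fin k → Fin n
    embed τ i = fromℕ< (<-≤-trans (positionAt<kP τ i) kP≤n)

    toℕ-embed : ∀ τ i → toℕ (embed τ i) ≡ positionAt τ i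
    toℕ-embed τ i = toℕ-fromℕ< _

    part-embed : ∀ τ i → part (toℕ (embed τ i)) ≡ i
    part-embed τ i = trans (cong part (toℕ-embed τ i)) (part-positionAt τ i)

    embed-increasing : ∀ τ i j → toℕ i < toℕ j → toℕ (embed τ i) < toℕ (embed τ j)
    embed-increasing τ i j i<j = subst₂ _<_ (sym (toℕ-embed τ i)) (sym (toℕ-embed τ j)) (begin-strict
      restAt τ i + toℕ i * P <⟨ +-monoˡ-< (toℕ i * P) (restAt<P τ i) ⟩
      suc (toℕ i) * P        ≤⟨ *-monoˡ-≤ P i<j ⟩
      toℕ j * P              ≤⟨ m≤n+m (toℕ j * P) (restAt τ j) ⟩
      restAt τ j + toℕ j * P ∎)
      where open ≤-Reasoning

    embed-induced : ∀ τ i j → adj (G n) (embed τ i) (embed τ j) ≡ adj K i j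
    embed-induced τ i j = trans (cong₂ linkedAt (toℕ-embed τ i) (toℕ-embed τ j)) (linkedAt-positionAt τ i j)

    embed-pair-disjoint : ∀ {τ σ} → τ ≢ σ → PairDisjoint (embed τ) (embed σ)
    embed-pair-disjoint {τ} {σ} τ≢σ i j i′ j′ same-i same-j with i Fin.≟ j
    ... | yes refl = refl
    ... | no i≢j   = ⊥-elim (τ≢σ (positionAt-injective i≢j (same-position same-i) (same-position same-j)))
      where
      same-part : ∀ {i i′} → embed τ i ≡ embed σ i′ → i ≡ i′
      same-part {i} {i′} same = trans (sym (part-embed τ i)) (trans (cong (part ∘ toℕ) same) (part-embed σ i′))
      same-position : ∀ {i i′} → embed τ i ≡ embed σ i′ → positionAt τ i ≡ positionAt σ i
      same-position {i} same with refl ← same-part same =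
        trans (sym (toℕ-embed τ i)) (trans (cong toℕ same) (toℕ-embed σ i))

    tuples : List Tuple
    tuples = cartesianProduct (allFin M) (cartesianProduct (allFin s) (cartesianProduct (allFin t) (allFin t)))

    tuples-unique : Unique tuples
    tuples-unique = Unique.cartesianProduct⁺ (Unique.allFin⁺ M)
      (Unique.cartesianProduct⁺ (Unique.allFin⁺ s) (Unique.cartesianProduct⁺ (Unique.allFin⁺ t) (Unique.allFin⁺ t)))

    length-tuples : length tuples ≡ M * (s * (t * t))
    length-tuples = trans (length-cartesianProductWith _,_ (allFin M) _) (cong₂ _*_ (length-allFin M)
      (trans (length-cartesianProductWith _,_ (allFin s) _) (cong₂ _*_ (length-allFin s)
        (trans (length-cartesianProductWith _,_ (allFin t) _) (cong₂ _*_ (length-allFin t) (length-allFin t))))))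

    planted : List (InducedCopy K (G n))
    planted = map (λ τ → embed τ , embed-increasing τ , embed-induced τ) tuples

    planted-pair-disjoint : AllPairs (λ φ ψ → PairDisjoint (proj₁ φ) (proj₁ ψ)) planted
    planted-pair-disjoint = AllPairs.map⁺ (AllPairs.map embed-pair-disjoint tuples-unique)

    length-planted : length planted ≡ M * (s * (t * t))
    length-planted = trans (length-map _ tuples) length-tuples

  module _ {n} {φ : Fin k → Fin n} (φ-copy : IsCopy K (G n) φ) where

    part-copy : ∀ i → part (toℕ (φ i)) ≡ i
    part-copy = K-core (part ∘ toℕ ∘ φ) (monotone , λ x y → proj₁ ∘ edge-aligned ∘ proj₂ φ-copy x y)
      where
      monotone : ∀ x y → toℕ x ≤ toℕ y → toℕ (part (toℕ (φ x))) ≤ toℕ (part (toℕ (φ y)))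
      monotone x y x≤y with m≤n⇒m<n∨m≡n x≤y
      ... | inj₁ x<y = part-mono-≤ (<⇒≤ (proj₁ φ-copy x y x<y))
      ... | inj₂ x≡y = ≤-reflexive (cong (toℕ ∘ part ∘ toℕ ∘ φ) (toℕ-injective x≡y))

    cycleHeight : Fin (3 + m) → ℕ
    cycleHeight j = height (toℕ (φ (v j)))

    label-part-cycle : ∀ j → label (part (toℕ (φ (v j)))) ≡ toℕ j
    label-part-cycle j = trans (cong label (part-copy (v j))) (label-cycle j)

    cycle-step : ∀ j → ∃ λ w → cycleHeight (fsuc j) ≡ cycleHeight (inject₁ j) + a w
    cycle-step j = w , consecutive-label-step _ _ (toℕ j) (a w) (begin
      cycleHeight (fsuc j) + toℕ j * a w
        ≡⟨ cong (λ l → cycleHeight (fsuc j) + l * a w) (trans (sym (toℕ-inject₁ j)) (sym (label-part-cycle (inject₁ j)))) ⟩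
      cycleHeight (fsuc j) + label (part (toℕ (φ (v (inject₁ j))))) * a w
        ≡⟨ proj₂ witness ⟩
      cycleHeight (inject₁ j) + label (part (toℕ (φ (v (fsuc j))))) * a w
        ≡⟨ cong (λ l → cycleHeight (inject₁ j) + l * a w) (label-part-cycle (fsuc j)) ⟩
      cycleHeight (inject₁ j) + suc (toℕ j) * a w ∎)
      where
      open ≡-Reasoning
      witness : ∃ (Aligned (part (toℕ (φ (v (inject₁ j))))) (cycleHeight (inject₁ j))
                           (part (toℕ (φ (v (fsuc j))))) (cycleHeight (fsuc j)))
      witness = proj₂ (edge-aligned (proj₂ φ-copy _ _ (v-path (inject₁ j) (fsuc j) (cong suc (sym (toℕ-inject₁ j))))))
      w : Fin s
      w = proj₁ witness

    cycle-close : ∃ λ c → cycleHeight fzero + (2 + m) * a c ≡ cycleHeight (fromℕ (2 + m))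
    cycle-close = c , (begin
      cycleHeight fzero + (2 + m) * a c
        ≡⟨ cong (λ l → cycleHeight fzero + l * a c) (trans (sym (toℕ-fromℕ (2 + m))) (sym (label-part-cycle (fromℕ (2 + m))))) ⟩
      cycleHeight fzero + label (part (toℕ (φ (v (fromℕ (2 + m)))))) * a c
        ≡⟨ proj₂ witness ⟩
      cycleHeight (fromℕ (2 + m)) + label (part (toℕ (φ (v fzero)))) * a c
        ≡⟨ cong (λ l → cycleHeight (fromℕ (2 + m)) + l * a c) (label-part-cycle fzero) ⟩
      cycleHeight (fromℕ (2 + m)) + 0
        ≡⟨ +-identityʳ _ ⟩
      cycleHeight (fromℕ (2 + m)) ∎)
      where
      open ≡-Reasoning
      witness : ∃ (Aligned (part (toℕ (φ (v (fromℕ (2 + m)))))) (cycleHeight (fromℕ (2 + m)))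
                           (part (toℕ (φ (v fzero)))) (cycleHeight fzero))
      witness = proj₂ (edge-aligned (proj₂ φ-copy _ _ v-close))
      c : Fin s
      c = proj₁ witness

    constant-step : ∃ λ c → ∀ j → cycleHeight (fsuc j) ≡ cycleHeight (inject₁ j) + a c
    constant-step = c , λ j → trans (proj₂ (cycle-step j)) (cong (λ w → cycleHeight (inject₁ j) + a w) (steps≡c j))
      where
      c : Fin s
      c = proj₁ cycle-close
      steps≡c : ∀ j → proj₁ (cycle-step j) ≡ c
      steps≡c = cycle-steps-constant {a = a} a-free cycleHeight (λ j → proj₁ (cycle-step j)) c
        (λ j → proj₂ (cycle-step j)) (proj₂ cycle-close)

  v₀ v₁ v₂ : Fin k
  v₀ = v fzero
  v₁ = v (fsuc fzero)
  v₂ = v (fsuc (fsuc fzero))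

  v₁≢v₀ : v₁ ≢ v₀
  v₁≢v₀ eq with v-injective eq
  ... | ()

  v₂≢v₀ : v₂ ≢ v₀
  v₂≢v₀ eq with v-injective eq
  ... | ()

  v₁≢v₂ : v₁ ≢ v₂
  v₁≢v₂ eq with v-injective eq
  ... | ()

  module Counting {n} (TM≤n : T * M ≤ n) where

    step : (Fin k → Fin n) → ℕ
    step φ = height (toℕ (φ v₁)) ∸ height (toℕ (φ v₀))

    module _ {φ : Fin k → Fin n} (φ-copy : IsCopy K (G n) φ) where

      private
        c : Fin s
        c = proj₁ (constant-step φ-copy)
        height-step : ∀ j → height (toℕ (φ (v (fsuc j)))) ≡ height (toℕ (φ (v (inject₁ j)))) + a c
        height-step = proj₂ (constant-step φ-copy)

      step≡ : step φ ≡ a c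
      step≡ = trans (cong (_∸ height (toℕ (φ v₀))) (height-step fzero)) (m+n∸m≡n (height (toℕ (φ v₀))) (a c))

      step<M : step φ < M
      step<M = subst (_< M) (sym step≡) (a<M c)

      height-v₁ : height (toℕ (φ v₁)) ≡ height (toℕ (φ v₀)) + step φ
      height-v₁ = trans (height-step fzero) (cong (height (toℕ (φ v₀)) +_) (sym step≡))

      height-v₂ : height (toℕ (φ v₂)) ≡ height (toℕ (φ v₁)) + step φ
      height-v₂ = trans (height-step (fsuc fzero)) (cong (height (toℕ (φ v₁)) +_) (sym step≡))

    -- The heights of φ v₁ and φ v₂ follow from φ v₀ and the step, so only their slots are
    -- recorded; the coordinate of v₁ also records the step.
    coordinate : (Fin k → Fin n) → Fin k → ℕ
    coordinate φ i with i Fin.≟ v₁ | i Fin.≟ v₂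
    ... | yes _ | _     = slot (toℕ (φ v₁)) + T * step φ
    ... | no _  | yes _ = slot (toℕ (φ v₂))
    ... | no _  | no _  = toℕ (φ i)

    bound : Fin k → ℕ
    bound i = if does (i Fin.≟ v₂) then T else n

    coordinate<bound : ∀ {φ} → IsCopy K (G n) φ → ∀ i → coordinate φ i < bound i
    coordinate<bound {φ} φ-copy i with i Fin.≟ v₁ | i Fin.≟ v₂
    ... | yes refl | yes v₁≡v₂ = ⊥-elim (v₁≢v₂ v₁≡v₂)
    ... | yes refl | no _      = <-≤-trans (digit-carry-< T {a′ = 0} (slot<T _) (step<M φ-copy)) TM≤n
    ... | no _     | yes _     = slot<T _
    ... | no _     | no _      = toℕ<n (φ i)

    coordinate-v₁ : ∀ φ → coordinate φ v₁ ≡ slot (toℕ (φ v₁)) + T * step φ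
    coordinate-v₁ φ with v₁ Fin.≟ v₁ | v₁ Fin.≟ v₂
    ... | yes _    | _ = refl
    ... | no v₁≢v₁ | _ = ⊥-elim (v₁≢v₁ refl)

    coordinate-v₂ : ∀ φ → coordinate φ v₂ ≡ slot (toℕ (φ v₂))
    coordinate-v₂ φ with v₂ Fin.≟ v₁ | v₂ Fin.≟ v₂
    ... | yes v₂≡v₁ | _        = ⊥-elim (v₁≢v₂ (sym v₂≡v₁))
    ... | no _      | yes _    = refl
    ... | no _      | no v₂≢v₂ = ⊥-elim (v₂≢v₂ refl)

    coordinate-other : ∀ φ {i} → i ≢ v₁ → i ≢ v₂ → coordinate φ i ≡ toℕ (φ i)
    coordinate-other φ {i} i≢v₁ i≢v₂ with i Fin.≟ v₁ | i Fin.≟ v₂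
    ... | yes i≡v₁ | _        = ⊥-elim (i≢v₁ i≡v₁)
    ... | no _     | yes i≡v₂ = ⊥-elim (i≢v₂ i≡v₂)
    ... | no _     | no _     = refl

    copy-determined : ∀ {φ ψ} → IsCopy K (G n) φ → IsCopy K (G n) ψ →
      (∀ i → coordinate φ i ≡ coordinate ψ i) → ∀ i → φ i ≡ ψ i
    copy-determined {φ} {ψ} φ-copy ψ-copy same = determined
      where
      position-v₀ : toℕ (φ v₀) ≡ toℕ (ψ v₀)
      position-v₀ = trans (sym (coordinate-other φ (v₁≢v₀ ∘ sym) (v₂≢v₀ ∘ sym)))
        (trans (same v₀) (coordinate-other ψ (v₁≢v₀ ∘ sym) (v₂≢v₀ ∘ sym)))

      slot-v₁×step : slot (toℕ (φ v₁)) ≡ slot (toℕ (ψ v₁)) × step φ ≡ step ψ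
      slot-v₁×step = divMod-unique T (slot<T _) (slot<T _)
        (trans (sym (coordinate-v₁ φ)) (trans (same v₁) (coordinate-v₁ ψ)))

      slot-v₂ : slot (toℕ (φ v₂)) ≡ slot (toℕ (ψ v₂))
      slot-v₂ = trans (sym (coordinate-v₂ φ)) (trans (same v₂) (coordinate-v₂ ψ))

      height-v₁≡ : height (toℕ (φ v₁)) ≡ height (toℕ (ψ v₁))
      height-v₁≡ = trans (height-v₁ φ-copy)
        (trans (cong₂ _+_ (cong height position-v₀) (proj₂ slot-v₁×step)) (sym (height-v₁ ψ-copy)))

      height-v₂≡ : height (toℕ (φ v₂)) ≡ height (toℕ (ψ v₂))
      height-v₂≡ = trans (height-v₂ φ-copy)
        (trans (cong₂ _+_ height-v₁≡ (proj₂ slot-v₁×step)) (sym (height-v₂ ψ-copy)))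

      vertex : ∀ i → height (toℕ (φ i)) ≡ height (toℕ (ψ i)) → slot (toℕ (φ i)) ≡ slot (toℕ (ψ i)) → φ i ≡ ψ i
      vertex i same-height same-slot =
        toℕ-injective (same-vertex (trans (part-copy φ-copy i) (sym (part-copy ψ-copy i))) same-height same-slot)

      determined : ∀ i → φ i ≡ ψ i
      determined i with i Fin.≟ v₁ | i Fin.≟ v₂
      ... | yes refl | _        = vertex v₁ height-v₁≡ (proj₁ slot-v₁×step)
      ... | no _     | yes refl = vertex v₂ height-v₂≡ slot-v₂
      ... | no i≢v₁  | no i≢v₂  =
        toℕ-injective (trans (sym (coordinate-other φ i≢v₁ i≢v₂)) (trans (same i) (coordinate-other ψ i≢v₁ i≢v₂)))

    code : Copy K (G n) → ℕ
    code (φ , _) = mixedRadix k bound (coordinate φ)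

    copies-bound : ∀ (L : List (Copy K (G n))) → AllPairs (λ φ ψ → DistinctMaps (proj₁ φ) (proj₁ ψ)) L →
      length L * M ≤ n ^ k
    copies-bound L distinct =
      ≤-trans (*-monoˡ-≤ M (length-≤-via-code code (∏ k bound) code<∏ separates L distinct)) (∏-update-≤ k v₂ TM≤n)
      where
      code<∏ : ∀ φ → code φ < ∏ k bound
      code<∏ (φ , φ-copy) = mixedRadix<∏ k (coordinate<bound φ-copy)
      separates : ∀ φ ψ → code φ ≡ code ψ → ¬ DistinctMaps (proj₁ φ) (proj₁ ψ)
      separates (φ , φ-copy) (ψ , ψ-copy) same-code distinct = distinct (copy-determined φ-copy ψ-copy
        (mixedRadix-injective k (coordinate<bound φ-copy) (coordinate<bound ψ-copy) same-code))

n<2^n : ∀ n → n < 2 ^ n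
n<2^n zero    = s≤s z≤n
n<2^n (suc n) = begin-strict
  suc n          <⟨ s≤s (n<2^n n) ⟩
  suc (2 ^ n)    ≤⟨ +-monoˡ-≤ (2 ^ n) (m^n>0 2 n) ⟩
  2 ^ n + 2 ^ n  ≡⟨ cong (2 ^ n +_) (+-identityʳ (2 ^ n)) ⟨
  2 ^ suc n      ∎
  where open ≤-Reasoning

^-distrib-* : ∀ a b q → (a * b) ^ q ≡ a ^ q * b ^ q
^-distrib-* a b zero    = refl
^-distrib-* a b (suc q) = trans (cong (a * b *_) (^-distrib-* a b q)) (interchange a b (a ^ q) (b ^ q))
  where
  interchange : ∀ a b x y → a * b * (x * y) ≡ a * x * (b * y)
  interchange = solve-∀

2^-cancel-< : ∀ {a b} → 2 ^ a < 2 ^ b → a < b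
2^-cancel-< {a} {b} 2^a<2^b = ≰⇒> (λ b≤a → <⇒≱ 2^a<2^b (^-monoʳ-≤ 2 b≤a))

quotient-sandwich : ∀ n c .{{_ : NonZero c}} → c ≤ n → c * (n / c) ≤ n × n ≤ 2 * (c * (n / c))
quotient-sandwich n c c≤n = ≤-trans (≤-reflexive (*-comm c (n / c))) (m/n*n≤m n c) , (begin
  n                          ≡⟨ m≡m%n+[m/n]*n n c ⟩
  n % c + n / c * c          ≤⟨ +-monoˡ-≤ (n / c * c) (<⇒≤ (m%n<n n c)) ⟩
  c + n / c * c              ≤⟨ +-monoˡ-≤ (n / c * c) (subst (_≤ n / c * c) (*-identityˡ c) (*-monoˡ-≤ c (m≥n⇒m/n>0 c≤n))) ⟩
  n / c * c + n / c * c      ≡⟨ double (n / c) c ⟩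
  2 * (c * (n / c))          ∎)
  where
  open ≤-Reasoning
  double : ∀ x c → x * c + x * c ≡ 2 * (c * x)
  double = solve-∀

n*n≤2^2n : ∀ n → n * n ≤ 2 ^ (2 * n)
n*n≤2^2n n = begin
  n * n           ≤⟨ *-mono-≤ (<⇒≤ (n<2^n n)) (<⇒≤ (n<2^n n)) ⟩
  2 ^ n * 2 ^ n   ≡⟨ ^-distribˡ-+-* 2 n n ⟨
  2 ^ (n + n)     ≡⟨ cong (λ x → 2 ^ (n + x)) (+-identityʳ n) ⟨
  2 ^ (2 * n)     ∎
  where open ≤-Reasoning

1+n*4^n≤2^[3n+1] : ∀ n → suc (n * (2 ^ n * 2 ^ n)) ≤ 2 ^ (3 * n + 1)
1+n*4^n≤2^[3n+1] n = begin
  suc (n * (2ⁿ * 2ⁿ))                 ≡⟨ +-comm 1 _ ⟩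
  n * (2ⁿ * 2ⁿ) + 1                   ≤⟨ +-mono-≤ (*-monoˡ-≤ (2ⁿ * 2ⁿ) (<⇒≤ (n<2^n n))) (*-mono-≤ 1≤2ⁿ (*-mono-≤ 1≤2ⁿ 1≤2ⁿ)) ⟩
  2ⁿ * (2ⁿ * 2ⁿ) + 2ⁿ * (2ⁿ * 2ⁿ)     ≡⟨ powers 2ⁿ ⟩
  2ⁿ * 2ⁿ * 2ⁿ * 2 ^ 1                ≡⟨ cong (λ x → x * 2ⁿ * 2 ^ 1) (^-distribˡ-+-* 2 n n) ⟨
  2 ^ (n + n) * 2ⁿ * 2 ^ 1            ≡⟨ cong (_* 2 ^ 1) (^-distribˡ-+-* 2 (n + n) n) ⟨
  2 ^ (n + n + n) * 2 ^ 1             ≡⟨ ^-distribˡ-+-* 2 (n + n + n) 1 ⟨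
  2 ^ (n + n + n + 1)                 ≡⟨ cong (λ x → 2 ^ (x + 1)) (triple n) ⟩
  2 ^ (3 * n + 1)                     ∎
  where
  open ≤-Reasoning
  2ⁿ : ℕ
  2ⁿ = 2 ^ n
  1≤2ⁿ : 1 ≤ 2ⁿ
  1≤2ⁿ = m^n>0 2 n
  powers : ∀ x → x * (x * x) + x * (x * x) ≡ x * x * x * 2 ^ 1
  powers = solve-∀
  triple : ∀ n → n + n + n ≡ 3 * n
  triple = solve-∀

behrend-loss≤ : ∀ C K e → 4 * (C * C) * K ^ e * suc (e * (2 ^ e * 2 ^ e)) ≤ 2 ^ ((K + 3) * e + (2 * C + 3))
behrend-loss≤ C K e = begin
  4 * (C * C) * K ^ e * suc (e * (2 ^ e * 2 ^ e))
    ≤⟨ *-mono-≤ (*-mono-≤ (*-monoʳ-≤ 4 (n*n≤2^2n C)) K^e≤2^Ke) (1+n*4^n≤2^[3n+1] e) ⟩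
  2 ^ 2 * 2 ^ (2 * C) * 2 ^ (K * e) * 2 ^ (3 * e + 1)
    ≡⟨ cong (λ x → x * 2 ^ (K * e) * 2 ^ (3 * e + 1)) (^-distribˡ-+-* 2 2 (2 * C)) ⟨
  2 ^ (2 + 2 * C) * 2 ^ (K * e) * 2 ^ (3 * e + 1)
    ≡⟨ cong (_* 2 ^ (3 * e + 1)) (^-distribˡ-+-* 2 (2 + 2 * C) (K * e)) ⟨
  2 ^ (2 + 2 * C + K * e) * 2 ^ (3 * e + 1)
    ≡⟨ ^-distribˡ-+-* 2 (2 + 2 * C + K * e) (3 * e + 1) ⟨
  2 ^ (2 + 2 * C + K * e + (3 * e + 1))
    ≡⟨ cong (2 ^_) (exponent C K e) ⟩
  2 ^ ((K + 3) * e + (2 * C + 3)) ∎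
  where
  open ≤-Reasoning
  exponent : ∀ C K e → 2 + 2 * C + K * e + (3 * e + 1) ≡ (K + 3) * e + (2 * C + 3)
  exponent = solve-∀
  K^e≤2^Ke : K ^ e ≤ 2 ^ (K * e)
  K^e≤2^Ke = ≤-trans (^-monoˡ-≤ e (<⇒≤ (n<2^n K))) (≤-reflexive (^-*-assoc 2 K e))

planted-density-arith : ∀ {ν δ n C M t s Z K Q D} → ν * Z ≤ δ → D ≤ Q * s → M ≡ K * D →
  4 * (C * C) * K * Q ≤ Z → n ≤ 2 * C * M * t → ν * (n * n) ≤ M * (s * (t * t)) * δ
planted-density-arith {ν} {δ} {n} {C} {M} {t} {s} {Z} {K} {Q} {D} νZ≤δ D≤Qs M≡KD loss≤Z n≤2CMt = begin
  ν * (n * n)                               ≤⟨ *-monoʳ-≤ ν (*-mono-≤ n≤2CMt n≤2CMt) ⟩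
  ν * ((2 * C * M * t) * (2 * C * M * t))   ≡⟨ square ν C M t ⟩
  ν * ((4 * (C * C) * M) * (M * (t * t)))   ≤⟨ *-monoʳ-≤ ν (*-monoˡ-≤ (M * (t * t)) 4C²M≤Zs) ⟩
  ν * ((Z * s) * (M * (t * t)))             ≡⟨ regroup ν Z s M t ⟩
  (ν * Z) * (M * (s * (t * t)))             ≤⟨ *-monoˡ-≤ _ νZ≤δ ⟩
  δ * (M * (s * (t * t)))                   ≡⟨ *-comm δ _ ⟩
  M * (s * (t * t)) * δ                     ∎
  where
  open ≤-Reasoning
  square : ∀ ν C M t → ν * ((2 * C * M * t) * (2 * C * M * t)) ≡ ν * ((4 * (C * C) * M) * (M * (t * t)))
  square = solve-∀
  regroup : ∀ ν Z s M t → ν * ((Z * s) * (M * (t * t))) ≡ (ν * Z) * (M * (s * (t * t)))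
  regroup = solve-∀
  reassociate : ∀ a b c d → a * (b * (c * d)) ≡ a * b * c * d
  reassociate = solve-∀
  4C²M≤Zs : 4 * (C * C) * M ≤ Z * s
  4C²M≤Zs = begin
    4 * (C * C) * M              ≡⟨ cong (4 * (C * C) *_) M≡KD ⟩
    4 * (C * C) * (K * D)        ≤⟨ *-monoʳ-≤ (4 * (C * C)) (*-monoʳ-≤ K D≤Qs) ⟩
    4 * (C * C) * (K * (Q * s))  ≡⟨ reassociate (4 * (C * C)) K Q s ⟩
    4 * (C * C) * K * Q * s      ≤⟨ *-monoˡ-≤ s loss≤Z ⟩
    Z * s                        ∎

-- LePowLog for ε = ν / δ, with the denominators cleared.
LePowLogℕ : (a b ν δ N D : ℕ) → Set
LePowLogℕ a b ν δ N D =
  ∀ p q → 1 ≤ q → ν ^ (q * a) * 2 ^ (p * b) < δ ^ (q * a) → N ^ q * δ ^ p ≤ ν ^ p * D ^ q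

-- The hypothesis gives p · 4g² < H q ≤ 2geq, hence H p ≤ e² q and δ^p ≤ ν^p 2^{H p} ≤ ν^p M^q.
sparse-arith : ∀ {ν δ N M D H e g} → H ≤ 2 * g * e → δ ≤ ν * 2 ^ H → N * M ≤ D → 2 ^ (e * e) ≤ M →
  LePowLogℕ 1 (4 * g * g) ν δ N D
sparse-arith {ν} {δ} {N} {M} {D} {H} {e} {g} H≤2ge δ≤ν2^H NM≤D 2^e²≤M p q _ small = begin
  N ^ q * δ ^ p                      ≤⟨ *-monoʳ-≤ (N ^ q) (^-monoˡ-≤ p δ≤ν2^H) ⟩
  N ^ q * (ν * 2 ^ H) ^ p            ≡⟨ cong (N ^ q *_) (trans (^-distrib-* ν (2 ^ H) p) (cong (ν ^ p *_) (^-*-assoc 2 H p))) ⟩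
  N ^ q * (ν ^ p * 2 ^ (H * p))      ≤⟨ *-monoʳ-≤ (N ^ q) (*-monoʳ-≤ (ν ^ p) (^-monoʳ-≤ 2 Hp≤e²q)) ⟩
  N ^ q * (ν ^ p * 2 ^ (e * e * q))  ≡⟨ cong (λ x → N ^ q * (ν ^ p * x)) (^-*-assoc 2 (e * e) q) ⟨
  N ^ q * (ν ^ p * (2 ^ (e * e)) ^ q) ≡⟨ swap (N ^ q) (ν ^ p) _ ⟩
  ν ^ p * (N ^ q * (2 ^ (e * e)) ^ q) ≡⟨ cong (ν ^ p *_) (^-distrib-* N (2 ^ (e * e)) q) ⟨
  ν ^ p * (N * 2 ^ (e * e)) ^ q      ≤⟨ *-monoʳ-≤ (ν ^ p) (^-monoˡ-≤ q (≤-trans (*-monoʳ-≤ N 2^e²≤M) NM≤D)) ⟩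
  ν ^ p * D ^ q                      ∎
  where
  open ≤-Reasoning
  swap : ∀ a b c → a * (b * c) ≡ b * (a * c)
  swap = solve-∀
  p4g²<Hq : p * (4 * g * g) < H * q
  p4g²<Hq = 2^-cancel-< (*-cancelˡ-< (ν ^ q) _ _ (begin-strict
    ν ^ q * 2 ^ (p * (4 * g * g))  ≡⟨ cong (λ x → ν ^ x * 2 ^ (p * (4 * g * g))) (*-identityʳ q) ⟨
    ν ^ (q * 1) * 2 ^ (p * (4 * g * g)) <⟨ small ⟩
    δ ^ (q * 1)                    ≡⟨ cong (δ ^_) (*-identityʳ q) ⟩
    δ ^ q                          ≤⟨ ^-monoˡ-≤ q δ≤ν2^H ⟩
    (ν * 2 ^ H) ^ q                ≡⟨ trans (^-distrib-* ν (2 ^ H) q) (cong (ν ^ q *_) (^-*-assoc 2 H q)) ⟩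
    ν ^ q * 2 ^ (H * q)            ∎))
  2gp<eq : 2 * g * p < e * q
  2gp<eq = *-cancelʳ-< (2 * g) _ _ (begin-strict
    2 * g * p * (2 * g)   ≡⟨ rearrange g p ⟩
    p * (4 * g * g)       <⟨ p4g²<Hq ⟩
    H * q                 ≤⟨ *-monoˡ-≤ q H≤2ge ⟩
    2 * g * e * q         ≡⟨ rearrange′ g e q ⟩
    e * q * (2 * g)       ∎)
    where
    rearrange : ∀ g p → 2 * g * p * (2 * g) ≡ p * (4 * g * g)
    rearrange = solve-∀
    rearrange′ : ∀ g e q → 2 * g * e * q ≡ e * q * (2 * g)
    rearrange′ = solve-∀
  Hp≤e²q : H * p ≤ e * e * q
  Hp≤e²q = begin
    H * p            ≤⟨ *-monoˡ-≤ p H≤2ge ⟩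
    2 * g * e * p    ≡⟨ rearrange g e p ⟩
    e * (2 * g * p)  ≤⟨ *-monoʳ-≤ e (<⇒≤ 2gp<eq) ⟩
    e * (e * q)      ≡⟨ *-assoc e e q ⟨
    e * e * q        ∎
    where
    rearrange : ∀ g e p → 2 * g * e * p ≡ e * (2 * g * p)
    rearrange = solve-∀

infix 4 _≃_÷_

record _≃_÷_ (x : ℚ) (a b : ℕ) : Set where
  constructor fraction
  field ≃-fraction : toℚᵘ x ℚᵘ.≃ mkℚᵘ (ℤ.+ a) (pred b)

open _≃_÷_


/-fraction : ∀ a n .{{_ : NonZero n}} → (ℤ.+ a ℚ./ n) ≃ a ÷ n
/-fraction a n@(suc _) = fraction (*≡* (begin
  ↥ᵘ q ℤ.* ℤ.+ n          ≡⟨ cong (ℤ._* ℤ.+ n) (ℚ.↥ᵘ-toℚᵘ q) ⟩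
  ↥ q ℤ.* ℤ.+ n           ≡⟨ cong (↥ q ℤ.*_) (ℚ.↧-/ (ℤ.+ a) n) ⟨
  ↥ q ℤ.* (↧ q ℤ.* g)   ≡⟨ swap (↥ q) (↧ q) g ⟩
  ↧ q ℤ.* (↥ q ℤ.* g)   ≡⟨ cong (↧ q ℤ.*_) (ℚ.↥-/ (ℤ.+ a) n) ⟩
  ↧ q ℤ.* ℤ.+ a           ≡⟨ ℤ.*-comm (↧ q) (ℤ.+ a) ⟩
  ℤ.+ a ℤ.* ↧ q           ≡⟨ cong (ℤ.+ a ℤ.*_) (ℚ.↧ᵘ-toℚᵘ q) ⟨
  ℤ.+ a ℤ.* ↧ᵘ q          ∎))
  where
  open ≡-Reasoning
  q = ℤ.+ a ℚ./ n
  g = gcd (ℤ.+ a) (ℤ.+ n)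
  ↥ᵘ ↧ᵘ : ℚ → ℤ.ℤ
  ↥ᵘ = ℚᵘ.↥_ ∘′ toℚᵘ
  ↧ᵘ = ℚᵘ.↧_ ∘′ toℚᵘ
  swap : ∀ x y z → x ℤ.* (y ℤ.* z) ≡ y ℤ.* (x ℤ.* z)
  swap x y z = trans (sym (ℤ.*-assoc x y z)) (trans (cong (ℤ._* z) (ℤ.*-comm x y)) (ℤ.*-assoc y x z))

ℕtoℚ-fraction : ∀ x → ℕtoℚ x ≃ x ÷ 1
ℕtoℚ-fraction x = /-fraction x 1

1ℚ-fraction : 1ℚ ≃ 1 ÷ 1
1ℚ-fraction = fraction ℚᵘ.≃-refl

*-fraction : ∀ {x y a b c d} .{{_ : NonZero b}} .{{_ : NonZero d}} →
  x ≃ a ÷ b → y ≃ c ÷ d → x *ℚ y ≃ a * c ÷ b * d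
*-fraction {x} {y} {a} {b@(suc _)} {c} {d@(suc _)} (fraction x≃) (fraction y≃) = fraction
  (ℚᵘ.≃-trans (ℚ.toℚᵘ-homo-* x y)
    (ℚᵘ.≃-trans (ℚᵘ.*-cong x≃ y≃) (*≡* (cong (ℤ._* ℤ.+ (b * d)) (sym (ℤ.pos-* a c))))))

^-fraction : ∀ {x a b} .{{_ : NonZero b}} → x ≃ a ÷ b → ∀ j → x ^ℚ j ≃ a ^ j ÷ b ^ j
^-fraction x≃ zero    = 1ℚ-fraction
^-fraction {b = b} ⦃ b≢0 ⦄ x≃ (suc j) = *-fraction ⦃ b≢0 ⦄ ⦃ m^n≢0 b j ⦄ x≃ (^-fraction x≃ j)

ℕtoℚ^-fraction : ∀ x j → ℕtoℚ x ^ℚ j ≃ x ^ j ÷ 1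
ℕtoℚ^-fraction x zero    = 1ℚ-fraction
ℕtoℚ^-fraction x (suc j) = *-fraction (ℕtoℚ-fraction x) (ℕtoℚ^-fraction x j)

private
  cross : ∀ a b′ c → ℤ.+ a ℤ.* ℚᵘ.↧ (mkℚᵘ (ℤ.+ c) b′) ≡ ℤ.+ (a * suc b′)
  cross a b′ c = sym (ℤ.pos-* a (suc b′))

cross-≤⇒≤ : ∀ {x y a b c d} .{{_ : NonZero b}} .{{_ : NonZero d}} →
  x ≃ a ÷ b → y ≃ c ÷ d → a * d ≤ c * b → x ≤ℚ y
cross-≤⇒≤ {a = a} {suc b′} {c} {suc d′} (fraction x≃) (fraction y≃) ad≤cb =
  ℚ.toℚᵘ-cancel-≤ (ℚᵘ.≤-respʳ-≃ (ℚᵘ.≃-sym y≃) (ℚᵘ.≤-respˡ-≃ (ℚᵘ.≃-sym x≃)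
    (*≤* (subst₂ ℤ._≤_ (sym (cross a d′ c)) (sym (cross c b′ a)) (ℤ.+≤+ ad≤cb)))))

<⇒cross-< : ∀ {x y a b c d} .{{_ : NonZero b}} .{{_ : NonZero d}} →
  x ≃ a ÷ b → y ≃ c ÷ d → x <ℚ y → a * d < c * b
<⇒cross-< {a = a} {suc b′} {c} {suc d′} (fraction x≃) (fraction y≃) x<y
  with ℚᵘ.<-respʳ-≃ y≃ (ℚᵘ.<-respˡ-≃ x≃ (ℚ.toℚᵘ-mono-< x<y))
... | *<* ad<cb = ℤ.drop‿+<+ (subst₂ ℤ._<_ (cross a d′ c) (cross c b′ a) ad<cb)

cross-<⇒< : ∀ {x y a b c d} .{{_ : NonZero b}} .{{_ : NonZero d}} →
  x ≃ a ÷ b → y ≃ c ÷ d → a * d < c * b → x <ℚ y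
cross-<⇒< {a = a} {suc b′} {c} {suc d′} (fraction x≃) (fraction y≃) ad<cb =
  ℚ.toℚᵘ-cancel-< (ℚᵘ.<-respʳ-≃ (ℚᵘ.≃-sym y≃) (ℚᵘ.<-respˡ-≃ (ℚᵘ.≃-sym x≃)
    (*<* (subst₂ ℤ._<_ (sym (cross a d′ c)) (sym (cross c b′ a)) (ℤ.+<+ ad<cb)))))

positive-fraction : ∀ (ε : ℚ) → 0ℚ <ℚ ε → ∃ λ ν → ε ≃ suc ν ÷ suc (ℚ.denominator-1 ε)
positive-fraction (mkℚ (ℤ.+ zero)   _ _) (ℚ.*<* (ℤ.+<+ ()))
positive-fraction (mkℚ (ℤ.+ suc ν)  _ _) _ = ν , fraction ℚᵘ.≃-refl
positive-fraction (mkℚ ℤ.-[1+ _ ]   _ _) (ℚ.*<* ())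

density-transfer : ∀ {ε ν δ} .{{_ : NonZero δ}} → ε ≃ ν ÷ δ → ∀ {X Y} → ν * X ≤ Y * δ →
  ε *ℚ ℕtoℚ X ≤ℚ ℕtoℚ Y
density-transfer {ν = ν} {δ} ε≃ {X} {Y} νX≤Yδ =
  cross-≤⇒≤ ⦃ m*n≢0 δ 1 ⦄ (*-fraction ε≃ (ℕtoℚ-fraction X)) (ℕtoℚ-fraction Y)
    (subst₂ _≤_ (sym (*-identityʳ (ν * X))) (cong (Y *_) (sym (*-identityʳ δ))) νX≤Yδ)

LePowLog-transfer : ∀ {ε ν δ} .{{_ : NonZero δ}} → ε ≃ ν ÷ δ → ∀ {a b N D} →
  LePowLogℕ a b ν δ N D → LePowLog a b ε N D
LePowLog-transfer {ν = ν} {δ} ε≃ {a} {b} {N} {D} bound p q 1≤q small =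
  cross-≤⇒≤ ⦃ _ ⦄ ⦃ m*n≢0 (δ ^ p) 1 ⦃ m^n≢0 δ p ⦄ ⦄
    (ℕtoℚ^-fraction N q) (*-fraction ⦃ m^n≢0 δ p ⦄ (^-fraction ε≃ p) (ℕtoℚ^-fraction D q))
    (subst₂ _≤_ (cong (N ^ q *_) (sym (*-identityʳ (δ ^ p)))) (sym (*-identityʳ _))
      (bound p q 1≤q (subst₂ _<_ (*-identityʳ _) (trans (*-identityˡ _) (*-identityʳ _))
        (<⇒cross-< ⦃ m*n≢0 (δ ^ (q * a)) 1 ⦃ m^n≢0 δ (q * a) ⦄ ⦄
          (*-fraction ⦃ m^n≢0 δ (q * a) ⦄ (^-fraction ε≃ (q * a)) (ℕtoℚ^-fraction 2 (p * b)))
          1ℚ-fraction small))))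

DenseSparse : ∀ {k} → OGraph k → (b ν δ n : ℕ) → Set
DenseSparse {k} K b ν δ n = Σ (OGraph n) λ G →
  HasHom G K ×
  (Σ (List (InducedCopy K G)) λ L →
    AllPairs (λ φ ψ → PairDisjoint (proj₁ φ) (proj₁ ψ)) L × ν * (n * n) ≤ length L * δ) ×
  (∀ (L : List (Copy K G)) → AllPairs (λ φ ψ → DistinctMaps (proj₁ φ) (proj₁ ψ)) L →
    LePowLogℕ 1 b ν δ (length L) (n ^ k))

DenseSparseℚ : ∀ {k} → OGraph k → (a b : ℕ) → ℚ → ℕ → Set
DenseSparseℚ {k} K a b ε n = Σ (OGraph n) λ G →
  HasHom G K ×
  (Σ (List (InducedCopy K G)) λ L →
    AllPairs (λ φ ψ → PairDisjoint (proj₁ φ) (proj₁ ψ)) L × ε *ℚ ℕtoℚ (n * n) ≤ℚ ℕtoℚ (length L)) ×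
  (∀ (L : List (Copy K G)) → AllPairs (λ φ ψ → DistinctMaps (proj₁ φ) (proj₁ ψ)) L →
    LePowLog a b ε (length L) (n ^ k))

DenseSparse⇒DenseSparseℚ : ∀ {k} {K : OGraph k} {b ν δ ε n} .{{_ : NonZero δ}} → ε ≃ ν ÷ δ →
  DenseSparse K b ν δ n → DenseSparseℚ K 1 b ε n
DenseSparse⇒DenseSparseℚ {k} {b = b} {n = n} ε≃ν/δ (G , hom , (L , disjoint , dense) , sparse) =
  G , hom , (L , disjoint , density-transfer ε≃ν/δ {n * n} {length L} dense) ,
  λ L′ distinct → LePowLog-transfer ε≃ν/δ {1} {b} {length L′} {n ^ k} (sparse L′ distinct)

-- Choice of parameters

-- C makes k · P = C · M · t in the construction, and 2 ^ X e bounds the loss factor of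
-- planted-density-arith (behrend-loss≤-X); the definitions are opaque so that 2 ^ X e is never
-- normalised.
module Parameters (k₀ m : ℕ) where

  k Λ : ℕ
  k = suc k₀
  Λ = 3 + m + k

  opaque
    C : ℕ
    C = k * (suc Λ * suc k)

    C-def : C ≡ k * (suc Λ * suc k)
    C-def = refl

    g : ℕ
    g = 2 + m + 3

    g-def : g ≡ 2 + m + 3
    g-def = refl

    c₁ : ℕ
    c₁ = 2 * C + 3

    c₁-def : c₁ ≡ 2 * C + 3
    c₁-def = refl

  instance
    C-nonZero : NonZero C
    C-nonZero = subst NonZero (sym C-def) _

    g-nonZero : NonZero g
    g-nonZero = subst NonZero (sym g-def) _

  e₀ b : ℕ
  e₀ = suc c₁
  b = 4 * g * g

  1≤b : 1 ≤ b
  1≤b = *-mono-≤ (*-mono-≤ (s≤s (z≤n {3})) 1≤g) 1≤g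
    where
    1≤g : 1 ≤ g
    1≤g = subst (1 ≤_) (sym g-def) (s≤s z≤n)

  X : ℕ → ℕ
  X e = g * e + c₁

  ε₀ : ℚ
  ε₀ = ℤ.+ 1 ℚ./ suc (2 ^ X e₀)

  ε₀-fraction : ε₀ ≃ 1 ÷ suc (2 ^ X e₀)
  ε₀-fraction = /-fraction 1 (suc (2 ^ X e₀))

  0<ε₀ : 0ℚ <ℚ ε₀
  0<ε₀ = cross-<⇒< (ℕtoℚ-fraction 0) ε₀-fraction (s≤s z≤n)

  <ε₀⇒ : ∀ {ε ν δ} .{{_ : NonZero δ}} → ε ≃ ν ÷ δ → ε <ℚ ε₀ → ν * suc (2 ^ X e₀) < δ
  <ε₀⇒ {ν = ν} {δ} ε≃ν/δ ε<ε₀ = subst (ν * suc (2 ^ X e₀) <_) (*-identityˡ δ) (<⇒cross-< ε≃ν/δ ε₀-fraction ε<ε₀)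

  modulus : ℕ → ℕ
  modulus e = ((2 + m) * 2 ^ e) ^ e

  modulus-nonZero : ∀ e → NonZero (modulus e)
  modulus-nonZero e = m^n≢0 ((2 + m) * 2 ^ e) e ⦃ m*n≢0 (2 + m) (2 ^ e) ⦃ _ ⦄ ⦃ m^n≢0 2 e ⦄ ⦄

  2^e²≤modulus : ∀ e → 2 ^ (e * e) ≤ modulus e
  2^e²≤modulus e = ≤-trans (≤-reflexive (sym (^-*-assoc 2 e e))) (^-monoˡ-≤ e (m≤n*m (2 ^ e) (2 + m)))

  behrend-loss≤-X : ∀ e → 4 * (C * C) * (2 + m) ^ e * suc (e * (2 ^ e * 2 ^ e)) ≤ 2 ^ X e
  behrend-loss≤-X e = subst (λ x → 4 * (C * C) * (2 + m) ^ e * suc (e * (2 ^ e * 2 ^ e)) ≤ 2 ^ x)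
    (cong₂ (λ g c → g * e + c) (sym g-def) (sym c₁-def)) (behrend-loss≤ C (2 + m) e)

  X-suc≤ : ∀ {e} → e₀ ≤ e → X (suc e) ≤ 2 * g * e
  X-suc≤ {e} e₀≤e = begin
    g * suc e + c₁       ≡⟨ split g e c₁ ⟩
    g * e + (g + c₁)     ≤⟨ +-monoʳ-≤ (g * e) (+-monoʳ-≤ g (m≤n*m c₁ g)) ⟩
    g * e + (g + g * c₁) ≡⟨ cong (g * e +_) (*-suc g c₁) ⟨
    g * e + g * e₀       ≤⟨ +-monoʳ-≤ (g * e) (*-monoʳ-≤ g e₀≤e) ⟩
    g * e + g * e        ≡⟨ double g e ⟩
    2 * g * e            ∎
    where
    open ≤-Reasoning
    split : ∀ g e c → g * suc e + c ≡ g * e + (g + c)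
    split = solve-∀
    double : ∀ g e → g * e + g * e ≡ 2 * g * e
    double = solve-∀

  digit-count : ∀ {ν δ} .{{_ : NonZero ν}} → ν * suc (2 ^ X e₀) < δ →
    ∃ λ e → e₀ ≤ e × ν * 2 ^ X e ≤ δ × δ ≤ ν * 2 ^ X (suc e)
  digit-count {ν} {δ} small with threshold (λ e → ν * 2 ^ X e ≤? δ) e₀ δ
    (≤-trans (*-monoʳ-≤ ν (n≤1+n _)) (<⇒≤ small))
    (λ le → <-irrefl refl (<-≤-trans (n<2^n δ) (≤-trans (^-monoʳ-≤ 2 δ≤X) (≤-trans (m≤n*m _ ν) le))))
    where
    δ≤X : δ ≤ X (e₀ + δ)
    δ≤X = ≤-trans (m≤n+m δ e₀) (≤-trans (m≤n*m (e₀ + δ) g) (m≤m+n _ c₁))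
  ... | e , e₀≤e , below , ¬below = e , e₀≤e , below , <⇒≤ (≰⇒> ¬below)

module _ {k₀} (K : OGraph (suc k₀)) (K-core : IsCore K)
  {m} (v : Fin (3 + m) → Fin (suc k₀)) (v-injective : Injective _≡_ _≡_ v)
  (v-path : ∀ i j → toℕ j ≡ suc (toℕ i) → Edge K (v i) (v j))
  (v-close : Edge K (v (fromℕ (2 + m))) (v fzero))
  where

  open Parameters k₀ m

  dense-sparse-at : ∀ {ν δ e s} {a : Fin s → ℕ} → e₀ ≤ e → ν * 2 ^ X e ≤ δ → δ ≤ ν * 2 ^ X (suc e) →
    (a<M : ∀ w → a w < modulus e) → AverageFree (2 + m) a → (2 ^ e) ^ e ≤ suc (e * (2 ^ e * 2 ^ e)) * s →
    ∀ n → C * modulus e ≤ n → DenseSparse K b ν δ n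
  dense-sparse-at {ν} {δ} {e} {s} {a} e₀≤e lower upper a<M a-free sphere-large n CM≤n =
    G n , (part ∘ toℕ , part-hom n) , (planted , planted-pair-disjoint , dense) , sparse
    where
    M : ℕ
    M = modulus e

    instance
      M-nonZero : NonZero M
      M-nonZero = modulus-nonZero e
      CM-nonZero : NonZero (C * M)
      CM-nonZero = m*n≢0 C M

    t : ℕ
    t = n / (C * M)

    instance
      t-nonZero : NonZero t
      t-nonZero = >-nonZero (m≥n⇒m/n>0 CM≤n)

    open Construction K K-core v v-injective v-path v-close a M a<M a-free t hiding (k; Λ)

    sandwich : C * M * t ≤ n × n ≤ 2 * (C * M * t)
    sandwich = quotient-sandwich n (C * M) CM≤n

    kP≤n : k * P ≤ n
    kP≤n = ≤-trans (≤-reflexive (trans (regroup k Λ M t) (cong (λ c → c * M * t) (sym C-def)))) (proj₁ sandwich)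
      where
      regroup : ∀ k Λ M t → k * ((suc Λ * M) * (suc k * t)) ≡ k * (suc Λ * suc k) * M * t
      regroup = solve-∀

    TM≤n : T * M ≤ n
    TM≤n = ≤-trans (*-monoʳ-≤ T (m≤n*m M (suc Λ))) (≤-trans (≤-reflexive (*-comm T H)) (≤-trans (m≤n*m P k) kP≤n))

    open Planted kP≤n
    open Counting TM≤n

    dense : ν * (n * n) ≤ length planted * δ
    dense = subst (λ x → ν * (n * n) ≤ x * δ) (sym length-planted)
      (planted-density-arith {ν} {δ} {n} {C} {M} {t} {s} {2 ^ X e} {(2 + m) ^ e} {suc (e * (2 ^ e * 2 ^ e))} {(2 ^ e) ^ e}
        lower sphere-large (^-distrib-* (2 + m) (2 ^ e) e) (behrend-loss≤-X e)
        (≤-trans (proj₂ sandwich) (≤-reflexive (reassociate C M t))))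
      where
      reassociate : ∀ C M t → 2 * (C * M * t) ≡ 2 * C * M * t
      reassociate = solve-∀

    sparse : ∀ (L : List (Copy K (G n))) → AllPairs (λ φ ψ → DistinctMaps (proj₁ φ) (proj₁ ψ)) L →
      LePowLogℕ 1 b ν δ (length L) (n ^ k)
    sparse L distinct = sparse-arith {ν} {δ} {length L} {M} {n ^ k} {X (suc e)} {e} {g}
      (X-suc≤ e₀≤e) upper (copies-bound L distinct) (2^e²≤modulus e)

  dense-sparse : ∀ {ν δ} .{{_ : NonZero ν}} → ν * suc (2 ^ X e₀) < δ → ∃[ N₀ ] ∀ n → N₀ ≤ n → DenseSparse K b ν δ n
  dense-sparse small with digit-count small
  ... | e , e₀≤e , lower , upper with behrend {2 + m} (2 ^ e) e (s≤s z≤n)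
  ... | _ , _ , a<M , a-free , sphere-large = C * modulus e , dense-sparse-at e₀≤e lower upper a<M a-free sphere-large

lemma3p6 : ∀ {k} (K : OGraph k) → IsCore K → HasCycle K →
    ∃[ a ] ∃[ b ] (1 ≤ a × 1 ≤ b ×
      Σ ℚ λ ε₀ → 0ℚ <ℚ ε₀ ×
        (∀ (ε : ℚ) → 0ℚ <ℚ ε → ε <ℚ ε₀ →
          ∃[ N₀ ] ∀ (n : ℕ) → N₀ ≤ n →
            Σ (OGraph n) λ G →
              HasHom G K ×
              (Σ (List (InducedCopy K G)) λ L →
                AllPairs (λ φ ψ → PairDisjoint (proj₁ φ) (proj₁ ψ)) L ×
                ε *ℚ ℕtoℚ (n * n) ≤ℚ ℕtoℚ (length L)) ×
              (∀ (L : List (Copy K G)) →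
                AllPairs (λ φ ψ → DistinctMaps (proj₁ φ) (proj₁ ψ)) L →
                LePowLog a b ε (length L) (n ^ k))))
lemma3p6 {zero} K _ (_ , v , _) with v fzero
... | ()
lemma3p6 {suc k₀} K K-core (m , v , v-injective , v-path , v-close) =
  1 , b , ≤-refl , 1≤b , ε₀ , 0<ε₀ , λ ε 0<ε ε<ε₀ →
    let _ , ε≃ν/δ = positive-fraction ε 0<ε
        N₀ , graphs = dense-sparse K K-core v v-injective v-path v-close (<ε₀⇒ ε≃ν/δ ε<ε₀)
    in N₀ , λ n N₀≤n → DenseSparse⇒DenseSparseℚ {K = K} {b} {n = n} ε≃ν/δ (graphs n N₀≤n)
  where open Parameters k₀ m
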